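{- Let $G$ be a connected graph such that for every hole $C$ of $G$ there is an edge $e_C\in E(C)$ which belongs to no induced cycle of $G$ other than $C$. Then $G$ has a connected spanning subgraph $G'$ such that (a) $G'$ contains all the triangles of $G$, and (b) $k(G')=1$.
   Context: All graphs are finite, simple and undirected. An induced cycle of $G$ is an induced subgraph that is a cycle (of any length $\ge3$); a triangle is a cycle of length $3$; a hole is an induced cycle of length at least $4$. The competition graph $C(D)$ of an acyclic digraph $D$ is the graph with vertex set $V(D)$ having an edge between distinct $x,y$ iff there is a vertex $v$ with $(x,v),(y,v)\in A(D)$. The competition number $k(G)$ is the smallest $k\ge0$ such that $G$ together with $k$ new isolated vertices is the competition graph of some acyclic digraph. -}

module Defs where

open import Data.Nat using (ℕ; zero; suc; _+_; _<?_)
open import Data.Fin using (Fin; toℕ; fromℕ<; splitAt)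
open import Data.Bool using (Bool; true; false)
open import Data.Sum using (_⊎_; inj₁; inj₂)
open import Data.Product using (Σ; _×_; _,_; ∃; ∃-syntax)
open import Data.Empty using (⊥)
open import Relation.Nullary using (¬_; yes; no)
open import Relation.Binary.PropositionalEquality using (_≡_; _≢_)
open import Function.Bundles using (_⇔_)
open import Function.Definitions using (Injective)

record Graph (n : ℕ) : Set where
  field
    adj    : Fin n → Fin n → Bool
    sym    : ∀ x y → adj x y ≡ adj y x
    irrefl : ∀ x → adj x x ≡ false
open Graph public

data Walk {n : ℕ} (G : Graph n) : Fin n → Fin n → Set where
  here : ∀ {x} → Walk G x x
  step : ∀ {x y z} → adj G x y ≡ true → Walk G y z → Walk G x z

Connected : ∀ {n} → Graph n → Set
Connected {n} G = (x y : Fin n) → Walk G x y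

cnext : ∀ {m} → Fin (suc m) → Fin (suc m)
cnext {m} i with suc (toℕ i) <? suc m
... | yes p = fromℕ< p
... | no _  = Fin.zero

record InducedCycle {n : ℕ} (G : Graph n) : Set where
  field
    len     : ℕ
    vert    : Fin (3 + len) → Fin n
    inj     : Injective _≡_ _≡_ vert
    induced : ∀ i j → (adj G (vert i) (vert j) ≡ true) ⇔ (j ≡ cnext i ⊎ i ≡ cnext j)
open InducedCycle public

Hole : ∀ {n} {G : Graph n} → InducedCycle G → Set
Hole C = len C ≢ 0

-- Vertex membership; two induced cycles are the same subgraph iff they have
-- the same vertex set (they are induced subgraphs).
_∈V_ : ∀ {n} {G : Graph n} → Fin n → InducedCycle G → Set
x ∈V C = ∃[ i ] vert C i ≡ x

SameCycle : ∀ {n} {G : Graph n} → InducedCycle G → InducedCycle G → Set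
SameCycle {n} C D = ∀ (x : Fin n) → (x ∈V C) ⇔ (x ∈V D)

EdgeOf : ∀ {n} {G : Graph n} → Fin n → Fin n → InducedCycle G → Set
EdgeOf x y C = ∃[ i ] ((vert C i ≡ x × vert C (cnext i) ≡ y) ⊎ (vert C i ≡ y × vert C (cnext i) ≡ x))

HoleUniqueEdgeProperty : ∀ {n} → Graph n → Set
HoleUniqueEdgeProperty G =
  ∀ (C : InducedCycle G) → Hole C →
    ∃[ i ] (∀ (D : InducedCycle G) → EdgeOf (vert C i) (vert C (cnext i)) D → SameCycle C D)

SpanningSubgraph : ∀ {n} → Graph n → Graph n → Set
SpanningSubgraph {n} H G = ∀ (x y : Fin n) → adj H x y ≡ true → adj G x y ≡ true

ContainsTriangles : ∀ {n} → Graph n → Graph n → Set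
ContainsTriangles {n} H G =
  ∀ (x y z : Fin n) → adj G x y ≡ true → adj G y z ≡ true → adj G x z ≡ true →
    adj H x y ≡ true × adj H y z ≡ true × adj H x z ≡ true

data DPath {N : ℕ} (A : Fin N → Fin N → Bool) : Fin N → Fin N → Set where
  arc  : ∀ {x y} → A x y ≡ true → DPath A x y
  cons : ∀ {x y z} → A x y ≡ true → DPath A y z → DPath A x z

Acyclic : ∀ {N} → (Fin N → Fin N → Bool) → Set
Acyclic {N} A = ∀ (x : Fin N) → ¬ DPath A x x

addIsolated : ∀ {n} → Graph n → (k : ℕ) → Fin (n + k) → Fin (n + k) → Bool
addIsolated {n} G k x y with splitAt n x | splitAt n y
... | inj₁ a | inj₁ b = adj G a b
... | _      | _      = false

IsCompetitionGraphOf : ∀ {N} → (Fin N → Fin N → Bool) → (Fin N → Fin N → Bool) → Set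
IsCompetitionGraphOf {N} H A =
  ∀ (x y : Fin N) → x ≢ y → (H x y ≡ true) ⇔ (∃[ v ] (A x v ≡ true × A y v ≡ true))

CompRepresentable : ∀ {n} → Graph n → ℕ → Set
CompRepresentable {n} G k =
  ∃[ A ] (Acyclic {n + k} A × IsCompetitionGraphOf (addIsolated G k) A)

CompetitionNumberIs : ∀ {n} → Graph n → ℕ → Set
CompetitionNumberIs G k = CompRepresentable G k × (∀ j → j Data.Nat.< k → ¬ CompRepresentable G j)

module Submission where

-- Let T be the spanning subgraph of G formed by the edges lying in a triangle.
-- (1) T is chordal (`triangleGraph-chordal`).  In a hole H of T take a
--     shortest G-chord (or none); the arc it cuts off is a hole C of G whose
--     edges, except the chord, are T-edges.  Its edge e_C is neither a T-edge
--     (it lies in a triangle) nor the chord (an induced path through the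
--     rest of H closes the chord into a second induced cycle).
-- (2) Maximum cardinality search on T, with ties at weight 0 broken towards
--     G-neighbours of the numbered vertices, gives an ordering in which the
--     earlier T-neighbours of each vertex form a T-clique and each vertex but
--     the first has an earlier G-neighbour (`mcsOrdering`, via `mcs-key`).
-- (3) G' = T plus, for each vertex without earlier T-neighbour, one edge to an
--     earlier G-neighbour (`Construction`).  It is connected and contains the
--     triangles; letting the closed earlier neighbourhood of the j-th vertex
--     prey on the (j+1)-th (the last one on a new vertex) represents G' ∪ I₁,
--     and a sink argument excludes a representation without new vertices.

open import Defs hiding (sym)
open import Data.Nat using (ℕ; zero; suc; _+_; _∸_; _≤_; _<_; _≥_; z≤n; s≤s; _<?_; _≤?_; z<s; s≤s⁻¹)
open import Data.Nat.Properties
open import Data.Nat.Induction using (<-rec)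
open import Data.Fin as F using (Fin; toℕ; fromℕ<; splitAt; _↑ˡ_; _↑ʳ_)
open import Data.Fin.Properties using (any?; toℕ-injective; toℕ<n; toℕ-fromℕ<; pigeonhole; injective⇒≤; splitAt-↑ˡ; splitAt-↑ʳ; splitAt⁻¹-↑ˡ)
open import Data.Bool using (Bool; true; false; _∧_; _∨_; not)
import Data.Bool as Bool
open import Data.Bool.Properties using (∨-comm; ∨-zeroʳ; ∧-comm)
open import Data.Maybe using (Maybe; just; nothing)
open import Data.List using (List; []; _∷_; allFin)
open import Data.List.Membership.Propositional using (_∈_)
open import Data.List.Membership.Propositional.Properties using (∈-allFin)
open import Data.List.Relation.Unary.Any using (here; there)
open import Data.Sum using (_⊎_; inj₁; inj₂)
open import Data.Product using (Σ; _×_; _,_; ∃; ∃-syntax; proj₁; proj₂)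
open import Data.Empty using (⊥; ⊥-elim)
open import Relation.Nullary using (¬_; yes; no; Dec; does)
open import Relation.Nullary.Decidable using (dec-true; _×-dec_; _⊎-dec_; ¬?)
open import Relation.Binary using (tri<; tri≈; tri>)
open import Relation.Binary.PropositionalEquality using (_≡_; _≢_; refl; sym; trans; cong; cong₂; subst; subst₂)
open import Function.Bundles using (_⇔_; mk⇔; Equivalence)

∧-true : ∀ {a b} → a ∧ b ≡ true → a ≡ true × b ≡ true
∧-true {true} {true} _ = refl , refl

true-∧ : ∀ {a b} → a ≡ true → b ≡ true → a ∧ b ≡ true
true-∧ refl refl = refl

∨-true : ∀ {a b} → a ∨ b ≡ true → a ≡ true ⊎ b ≡ true
∨-true {true} _ = inj₁ refl
∨-true {false} {true} _ = inj₂ refl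

t≢f : true ≢ false
t≢f ()

≢true⇒false : ∀ {b} → b ≢ true → b ≡ false
≢true⇒false {false} _ = refl
≢true⇒false {true} h = ⊥-elim (h refl)

not-true : ∀ {b} → not b ≡ true → b ≡ false
not-true {false} _ = refl

does-true : ∀ {A : Set} (d : Dec A) → does d ≡ true → A
does-true (yes a) _ = a

eqb : ∀ {n} → Fin n → Fin n → Bool
eqb u v = does (u F.≟ v)

eqb-true : ∀ {n} {u v : Fin n} → eqb u v ≡ true → u ≡ v
eqb-true {u = u} {v} = does-true (u F.≟ v)

eqb-refl : ∀ {n} (u : Fin n) → eqb u u ≡ true
eqb-refl u = dec-true (u F.≟ u) refl

anyFin : ∀ {n} → (Fin n → Bool) → Bool
anyFin {zero} p = false
anyFin {suc n} p = p F.zero ∨ anyFin (λ x → p (F.suc x))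

anyFin-sound : ∀ {n} (p : Fin n → Bool) → anyFin p ≡ true → ∃[ x ] p x ≡ true
anyFin-sound {suc n} p e with p F.zero in eq
... | true = F.zero , eq
... | false with anyFin-sound (λ x → p (F.suc x)) e
... | x , q = F.suc x , q

anyFin-complete : ∀ {n} (p : Fin n → Bool) (x : Fin n) → p x ≡ true → anyFin p ≡ true
anyFin-complete {suc n} p F.zero e with p F.zero
... | true = refl
anyFin-complete {suc n} p (F.suc x) e with p F.zero
... | true = refl
... | false = anyFin-complete (λ y → p (F.suc y)) x e

anyFin-cong : ∀ {n} (p q : Fin n → Bool) → (∀ x → p x ≡ q x) → anyFin p ≡ anyFin q
anyFin-cong {zero} p q e = refl
anyFin-cong {suc n} p q e = cong₂ _∨_ (e F.zero) (anyFin-cong _ _ (λ x → e (F.suc x)))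

firstFin : ∀ {n} → (Fin n → Bool) → Maybe (Fin n)
firstFin {zero} p = nothing
firstFin {suc n} p with p F.zero
... | true = just F.zero
... | false with firstFin (λ x → p (F.suc x))
...   | just x = just (F.suc x)
...   | nothing = nothing

firstFin-just : ∀ {n} (p : Fin n → Bool) {u} → firstFin p ≡ just u → p u ≡ true
firstFin-just {suc n} p {u} e with p F.zero in e0
firstFin-just {suc n} p {.F.zero} refl | true = e0
... | false with firstFin (λ x → p (F.suc x)) in e1
firstFin-just {suc n} p {.(F.suc x)} refl | false | just x = firstFin-just (λ x → p (F.suc x)) e1

firstFin-nothing : ∀ {n} (p : Fin n → Bool) → firstFin p ≡ nothing → ∀ u → p u ≡ false
firstFin-nothing {suc n} p e u with p F.zero in e0
firstFin-nothing {suc n} p () u | true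
... | false with firstFin (λ x → p (F.suc x)) in e1
firstFin-nothing {suc n} p () u | false | just x
firstFin-nothing {suc n} p refl F.zero | false | nothing = e0
firstFin-nothing {suc n} p refl (F.suc u) | false | nothing = firstFin-nothing (λ x → p (F.suc x)) e1 u

indicator : Bool → ℕ
indicator true = 1
indicator false = 0

countFin : ∀ {n} → (Fin n → Bool) → ℕ
countFin {zero} p = 0
countFin {suc n} p = indicator (p F.zero) + countFin (λ x → p (F.suc x))

indicator-mono : ∀ {a b} → (a ≡ true → b ≡ true) → indicator a ≤ indicator b
indicator-mono {false} h = z≤n
indicator-mono {true} h rewrite h refl = ≤-refl

countFin-mono : ∀ {n} (p q : Fin n → Bool) → (∀ x → p x ≡ true → q x ≡ true) → countFin p ≤ countFin q
countFin-mono {zero} p q h = z≤n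
countFin-mono {suc n} p q h = +-mono-≤ (indicator-mono (h F.zero)) (countFin-mono _ _ (λ x → h (F.suc x)))

countFin-strict : ∀ {n} (p q : Fin n → Bool) → (∀ x → p x ≡ true → q x ≡ true) →
                  (w : Fin n) → q w ≡ true → p w ≡ false → countFin p < countFin q
countFin-strict {suc n} p q h F.zero qw pw rewrite qw | pw = s≤s (countFin-mono _ _ (λ x → h (F.suc x)))
countFin-strict {suc n} p q h (F.suc w) qw pw =
  +-mono-≤-< (indicator-mono (h F.zero)) (countFin-strict _ _ (λ x → h (F.suc x)) w qw pw)

countFin-pos : ∀ {n} (p : Fin n → Bool) → 0 < countFin p → ∃[ x ] p x ≡ true
countFin-pos {suc n} p h with p F.zero in e
... | true = F.zero , e
... | false with countFin-pos (λ x → p (F.suc x)) h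
... | x , q = F.suc x , q

leastBelow : (m : ℕ) {P : ℕ → Set} → (∀ i → Dec (P i)) →
  (∃ λ i → i < m × P i × (∀ j → j < i → ¬ P j)) ⊎ (∀ i → i < m → ¬ P i)
leastBelow zero d = inj₂ (λ { _ () })
leastBelow (suc m) {P} d with leastBelow m d
... | inj₁ (i , i<m , p , least) = inj₁ (i , m<n⇒m<1+n i<m , p , least)
... | inj₂ none with d m
...   | yes p = inj₁ (m , ≤-refl , p , none)
...   | no ¬p = inj₂ noneBelow
  where
  noneBelow : ∀ i → i < suc m → ¬ P i
  noneBelow i i<sm with m≤n⇒m<n∨m≡n (s≤s⁻¹ i<sm)
  ... | inj₁ i<m = none i i<m
  ... | inj₂ refl = ¬p

greatestUpTo : (m : ℕ) {P : ℕ → Set} → (∀ i → Dec (P i)) → P 0 →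
  ∃ λ i → i ≤ m × P i × (∀ j → i < j → j ≤ m → ¬ P j)
greatestUpTo zero d p0 = 0 , z≤n , p0 , λ j i<j j≤ _ → <-irrefl refl (<-≤-trans i<j j≤)
greatestUpTo (suc m) {P} d p0 with d (suc m)
... | yes q = suc m , ≤-refl , q , λ j i<j j≤ _ → <-irrefl refl (<-≤-trans i<j j≤)
... | no ¬q with greatestUpTo m d p0
... | i , i≤ , pi , greatest = i , m≤n⇒m≤1+n i≤ , pi , noneAbove
  where
  noneAbove : ∀ j → i < j → j ≤ suc m → ¬ P j
  noneAbove j i<j j≤ pj with m≤n⇒m<n∨m≡n j≤
  ... | inj₁ j<sm = greatest j i<j (s≤s⁻¹ j<sm) pj
  ... | inj₂ refl = ¬q pj

pairBelow : (m : ℕ) {Q : ℕ → ℕ → Set} → (∀ i j → Dec (Q i j)) →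
  (∃ λ i → ∃ λ j → i < j × j < m × Q i j) ⊎ (∀ i j → i < j → j < m → ¬ Q i j)
pairBelow m {Q} d with anyUpTo? (λ j → anyUpTo? (λ i → d i j) j) m
... | yes (j , j<m , i , i<j , q) = inj₁ (i , j , i<j , j<m , q)
... | no none = inj₂ (λ i j i<j j<m q → none (j , j<m , i , i<j , q))

swap+ : ∀ a b c → a + b + c ≡ a + c + b
swap+ a b c = trans (+-assoc a b c) (trans (cong (a +_) (+-comm b c)) (sym (+-assoc a c b)))

a+b≡a : ∀ a b → a + b ≡ a → b ≡ 0
a+b≡a a b e = +-cancelˡ-≡ a b 0 (trans e (sym (+-identityʳ a)))

a+b≤a : ∀ a b → a + b ≤ a → b ≡ 0
a+b≤a a b h = a+b≡a a b (≤-antisym h (m≤m+n a b))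

+-suc-suc : ∀ a i → a + suc (suc i) ≡ suc (suc (a + i))
+-suc-suc a i = trans (+-suc a (suc i)) (cong suc (+-suc a i))

a+2≡ : ∀ a → a + 2 ≡ suc (suc a)
a+2≡ a = trans (+-suc-suc a 0) (cong (λ z → suc (suc z)) (+-identityʳ a))

lt-sum : ∀ x e → x < x + suc e
lt-sum x e = m<m+n x z<s

positive-summand : ∀ a b → a < a + b → 0 < b
positive-summand a zero h = ⊥-elim (<-irrefl (sym (+-identityʳ a)) h)
positive-summand a (suc b) _ = z<s

sucEq : ∀ {i k} → i < k → ¬ (suc i < k) → suc i ≡ k
sucEq p q = ≤-antisym p (≮⇒≥ q)

sub-suc : ∀ m i → i < m → m ∸ i ≡ suc (m ∸ suc i)
sub-suc (suc m) zero _ = refl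
sub-suc (suc m) (suc i) (s≤s h) = sub-suc m i h

adj⇒≢ : ∀ {n} (X : Graph n) {a b} → adj X a b ≡ true → a ≢ b
adj⇒≢ X {a} e refl = t≢f (trans (sym e) (irrefl X a))

adj-sym : ∀ {n} (X : Graph n) {a b} → adj X a b ≡ true → adj X b a ≡ true
adj-sym X {a} {b} e = trans (Graph.sym X b a) e

walk-reverse : ∀ {n} {X : Graph n} {x y} → Walk X x y → Walk X y x
walk-reverse {X = X} w = go w here
  where
  go : ∀ {a b c} → Walk X a b → Walk X a c → Walk X b c
  go here acc = acc
  go (step e w) acc = go w (step (adj-sym X e) acc)

walk-append : ∀ {n} {X : Graph n} {x y z} → Walk X x y → Walk X y z → Walk X x z
walk-append here w = w
walk-append (step e w) w' = step e (walk-append w w')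

crossingEdge : ∀ {n} (X : Graph n) (S : Fin n → Set) → (∀ u → Dec (S u)) → ∀ {x y} → Walk X x y → S x → ¬ S y →
               ∃ λ u → ∃ λ v → S u × ¬ S v × adj X u v ≡ true
crossingEdge X S d here sx ¬sy = ⊥-elim (¬sy sx)
crossingEdge X S d {x} (step {y = x'} a w) sx ¬sy with d x'
... | yes sx' = crossingEdge X S d w sx' ¬sy
... | no ¬sx' = x , x' , sx , ¬sx' , a

-- Induced cycles presented by ℕ-indexed vertex sequences.  Index arithmetic
-- on ℕ is far more convenient than on Fin; `toInducedCycle` converts.

CycAdj : ℕ → ℕ → ℕ → Set
CycAdj k i j = (suc i ≡ j) ⊎ (suc j ≡ i) ⊎ (i ≡ 0 × suc j ≡ k) ⊎ (j ≡ 0 × suc i ≡ k)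

CycAdj-sym : ∀ {k i j} → CycAdj k i j → CycAdj k j i
CycAdj-sym (inj₁ x) = inj₂ (inj₁ x)
CycAdj-sym (inj₂ (inj₁ x)) = inj₁ x
CycAdj-sym (inj₂ (inj₂ (inj₁ x))) = inj₂ (inj₂ (inj₂ x))
CycAdj-sym (inj₂ (inj₂ (inj₂ x))) = inj₂ (inj₂ (inj₁ x))

record IndexedCycle {n : ℕ} (X : Graph n) : Set where
  field
    extra        : ℕ
    vertex       : ℕ → Fin n
    vertex-inj   : ∀ i j → i < 3 + extra → j < 3 + extra → vertex i ≡ vertex j → i ≡ j
    adj⇒cycAdj   : ∀ i j → i < 3 + extra → j < 3 + extra → adj X (vertex i) (vertex j) ≡ true → CycAdj (3 + extra) i j
    cycAdj⇒adj   : ∀ i j → i < 3 + extra → j < 3 + extra → CycAdj (3 + extra) i j → adj X (vertex i) (vertex j) ≡ true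

cnext-lt : ∀ {m} (i : Fin (suc m)) → suc (toℕ i) < suc m → toℕ (cnext i) ≡ suc (toℕ i)
cnext-lt {m} i p with suc (toℕ i) <? suc m
... | yes q = toℕ-fromℕ< q
... | no ¬q = ⊥-elim (¬q p)

cnext-ge : ∀ {m} (i : Fin (suc m)) → ¬ (suc (toℕ i) < suc m) → toℕ (cnext i) ≡ 0
cnext-ge {m} i p with suc (toℕ i) <? suc m
... | yes q = ⊥-elim (p q)
... | no ¬q = refl

cnext⇒CycAdj : ∀ {m} (i j : Fin (suc m)) → j ≡ cnext i → CycAdj (suc m) (toℕ i) (toℕ j)
cnext⇒CycAdj {m} i j refl = byCase (suc (toℕ i) <? suc m)
  where
  byCase : Dec (suc (toℕ i) < suc m) → CycAdj (suc m) (toℕ i) (toℕ (cnext i))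
  byCase (yes q) = inj₁ (sym (cnext-lt i q))
  byCase (no ¬q) = inj₂ (inj₂ (inj₂ (cnext-ge i ¬q , sucEq (toℕ<n i) ¬q)))

CycAdj⇒cnext : ∀ {m} (i j : Fin (suc m)) → CycAdj (suc m) (toℕ i) (toℕ j) → j ≡ cnext i ⊎ i ≡ cnext j
CycAdj⇒cnext {m} i j (inj₁ e) =
  inj₁ (toℕ-injective (trans (sym e) (sym (cnext-lt i (subst (_< suc m) (sym e) (toℕ<n j))))))
CycAdj⇒cnext {m} i j (inj₂ (inj₁ e)) =
  inj₂ (toℕ-injective (trans (sym e) (sym (cnext-lt j (subst (_< suc m) (sym e) (toℕ<n i))))))
CycAdj⇒cnext {m} i j (inj₂ (inj₂ (inj₁ (e1 , e2)))) =
  inj₂ (toℕ-injective (trans e1 (sym (cnext-ge j (λ q → <-irrefl e2 q)))))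
CycAdj⇒cnext {m} i j (inj₂ (inj₂ (inj₂ (e1 , e2)))) =
  inj₁ (toℕ-injective (trans e1 (sym (cnext-ge i (λ q → <-irrefl e2 q)))))

ordered⇒cycAdj : ∀ {n} (X : Graph n) (g : ℕ → Fin n) (K : ℕ) →
  (∀ i j → i < j → j < K → adj X (g i) (g j) ≡ true → suc i ≡ j ⊎ (i ≡ 0 × suc j ≡ K)) →
  ∀ i j → i < K → j < K → adj X (g i) (g j) ≡ true → CycAdj K i j
ordered⇒cycAdj X g K ordered i j hi hj a with <-cmp i j
... | tri< i<j _ _ = fromOrdered (ordered i j i<j hj a)
  where
  fromOrdered : suc i ≡ j ⊎ (i ≡ 0 × suc j ≡ K) → CycAdj K i j
  fromOrdered (inj₁ e) = inj₁ e
  fromOrdered (inj₂ e) = inj₂ (inj₂ (inj₁ e))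
... | tri≈ _ refl _ = ⊥-elim (adj⇒≢ X a refl)
... | tri> _ _ j<i = CycAdj-sym (fromOrdered (ordered j i j<i hi (adj-sym X a)))
  where
  fromOrdered : suc j ≡ i ⊎ (j ≡ 0 × suc i ≡ K) → CycAdj K j i
  fromOrdered (inj₁ e) = inj₁ e
  fromOrdered (inj₂ e) = inj₂ (inj₂ (inj₁ e))

toInducedCycle : ∀ {n} {X : Graph n} → IndexedCycle X → InducedCycle X
toInducedCycle {n} {X} c = record
  { len = extra
  ; vert = λ i → vertex (toℕ i)
  ; inj = λ {i} {j} e → toℕ-injective (vertex-inj (toℕ i) (toℕ j) (toℕ<n i) (toℕ<n j) e)
  ; induced = λ i j → mk⇔
      (λ a → CycAdj⇒cnext i j (adj⇒cycAdj (toℕ i) (toℕ j) (toℕ<n i) (toℕ<n j) a))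
      (λ { (inj₁ e) → cycAdj⇒adj _ _ (toℕ<n i) (toℕ<n j) (cnext⇒CycAdj i j e)
         ; (inj₂ e) → cycAdj⇒adj _ _ (toℕ<n i) (toℕ<n j) (CycAdj-sym (cnext⇒CycAdj j i e)) })
  }
  where open IndexedCycle c

triangle : ∀ {n} (X : Graph n) {u v w : Fin n} →
           adj X u v ≡ true → adj X v w ≡ true → adj X u w ≡ true → InducedCycle X
triangle {n} X {u} {v} {w} uv vw uw = record
  { len = 0 ; vert = corner ; inj = λ {i} {j} → corner-inj i j
  ; induced = λ i j → mk⇔ (consecutive i j) (λ { (inj₁ refl) → edge i ; (inj₂ refl) → adj-sym X (edge j) }) }
  where
  corner : Fin 3 → Fin n
  corner F.zero = u
  corner (F.suc F.zero) = v
  corner (F.suc (F.suc F.zero)) = w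
  edge : ∀ i → adj X (corner i) (corner (cnext i)) ≡ true
  edge F.zero = uv
  edge (F.suc F.zero) = vw
  edge (F.suc (F.suc F.zero)) = adj-sym X uw
  corner-inj : ∀ i j → corner i ≡ corner j → i ≡ j
  corner-inj F.zero F.zero _ = refl
  corner-inj F.zero (F.suc F.zero) e = ⊥-elim (adj⇒≢ X uv e)
  corner-inj F.zero (F.suc (F.suc F.zero)) e = ⊥-elim (adj⇒≢ X uw e)
  corner-inj (F.suc F.zero) F.zero e = ⊥-elim (adj⇒≢ X uv (sym e))
  corner-inj (F.suc F.zero) (F.suc F.zero) _ = refl
  corner-inj (F.suc F.zero) (F.suc (F.suc F.zero)) e = ⊥-elim (adj⇒≢ X vw e)
  corner-inj (F.suc (F.suc F.zero)) F.zero e = ⊥-elim (adj⇒≢ X uw (sym e))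
  corner-inj (F.suc (F.suc F.zero)) (F.suc F.zero) e = ⊥-elim (adj⇒≢ X vw (sym e))
  corner-inj (F.suc (F.suc F.zero)) (F.suc (F.suc F.zero)) _ = refl
  consecutive : ∀ i j → adj X (corner i) (corner j) ≡ true → j ≡ cnext i ⊎ i ≡ cnext j
  consecutive F.zero F.zero e = ⊥-elim (adj⇒≢ X e refl)
  consecutive F.zero (F.suc F.zero) _ = inj₁ refl
  consecutive F.zero (F.suc (F.suc F.zero)) _ = inj₂ refl
  consecutive (F.suc F.zero) F.zero _ = inj₂ refl
  consecutive (F.suc F.zero) (F.suc F.zero) e = ⊥-elim (adj⇒≢ X e refl)
  consecutive (F.suc F.zero) (F.suc (F.suc F.zero)) _ = inj₁ refl
  consecutive (F.suc (F.suc F.zero)) F.zero _ = inj₁ refl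
  consecutive (F.suc (F.suc F.zero)) (F.suc F.zero) _ = inj₂ refl
  consecutive (F.suc (F.suc F.zero)) (F.suc (F.suc F.zero)) e = ⊥-elim (adj⇒≢ X e refl)

sameCycle⇒len≤ : ∀ {n} {X : Graph n} (C D : InducedCycle X) → SameCycle C D → 3 + len C ≤ 3 + len D
sameCycle⇒len≤ C D same = injective⇒≤ {f = position} position-inj
  where
  inD : ∀ i → ∃[ j ] vert D j ≡ vert C i
  inD i = Equivalence.to (same (vert C i)) (i , refl)
  position : Fin (3 + len C) → Fin (3 + len D)
  position i = proj₁ (inD i)
  position-inj : ∀ {i i'} → position i ≡ position i' → i ≡ i'
  position-inj {i} {i'} e = inj C (trans (sym (proj₂ (inD i))) (trans (cong (vert D) e) (proj₂ (inD i'))))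

module TriangleGraph {n} (G : Graph n) where
  inTriangle : Fin n → Fin n → Bool
  inTriangle u v = adj G u v ∧ anyFin (λ z → adj G u z ∧ adj G v z)

  T : Graph n
  T = record
    { adj = inTriangle
    ; sym = λ u v → cong₂ _∧_ (Graph.sym G u v) (anyFin-cong _ _ (λ z → ∧-comm (adj G u z) (adj G v z)))
    ; irrefl = λ u → cong (λ b → b ∧ anyFin (λ z → adj G u z ∧ adj G u z)) (irrefl G u) }

  tadj : Fin n → Fin n → Bool
  tadj = adj T

  T⊆G : ∀ {u v} → tadj u v ≡ true → adj G u v ≡ true
  T⊆G e = proj₁ (∧-true e)

  apex : ∀ {u v} → tadj u v ≡ true → ∃[ z ] (adj G u z ≡ true × adj G v z ≡ true)
  apex {u} {v} e with anyFin-sound (λ z → adj G u z ∧ adj G v z) (proj₂ (∧-true e))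
  ... | z , q = z , ∧-true q

  triangle⇒T : ∀ {u v z} → adj G u v ≡ true → adj G u z ≡ true → adj G v z ≡ true → tadj u v ≡ true
  triangle⇒T {u} {v} {z} uv uz vz = true-∧ uv (anyFin-complete (λ z → adj G u z ∧ adj G v z) z (true-∧ uz vz))

  tadj-sym : ∀ {u v} → tadj u v ≡ true → tadj v u ≡ true
  tadj-sym = adj-sym T

  -- An edge of a hole C of G that lies in a triangle also lies in that
  -- triangle, an induced cycle with a different vertex set; so it is never
  -- the edge e_C of the hypothesis.
  uniqueEdge-notInTriangle : (C : InducedCycle G) → Hole C → (i : Fin (3 + len C)) →
    (∀ D → EdgeOf (vert C i) (vert C (cnext i)) D → SameCycle C D) →
    tadj (vert C i) (vert C (cnext i)) ≡ true → ⊥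
  uniqueEdge-notInTriangle C hC i unique te with apex te
  ... | z , uz , vz = hC (n≤0⇒n≡0 (+-cancelˡ-≤ 3 (len C) 0 (sameCycle⇒len≤ C D (unique D (F.zero , inj₁ (refl , refl))))))
    where
    D : InducedCycle G
    D = triangle G (T⊆G te) vz uz

record Path {n : ℕ} (X : Graph n) (x y : Fin n) : Set where
  constructor mkP
  field
    m    : ℕ
    p    : ℕ → Fin n
    p0   : p 0 ≡ x
    pm   : p m ≡ y
    stp  : ∀ i → i < m → adj X (p i) (p (suc i)) ≡ true

module _ {n : ℕ} {X : Graph n} {x y : Fin n} where
  open Path

  InducedPath : Path X x y → Set
  InducedPath P = (∀ i j → i ≤ m P → j ≤ m P → p P i ≡ p P j → i ≡ j) ×
                  (∀ i j → i ≤ m P → j ≤ m P → adj X (p P i) (p P j) ≡ true → suc i ≡ j ⊎ suc j ≡ i)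

  VerticesWithin : Path X x y → Path X x y → Set
  VerticesWithin P' P = ∀ l → l ≤ m P' → ∃ λ i → i ≤ m P × p P' l ≡ p P i

  within-trans : ∀ {P'' P' P} → VerticesWithin P'' P' → VerticesWithin P' P → VerticesWithin P'' P
  within-trans o2 o1 l l≤ with o2 l l≤
  ... | i , i≤ , e with o1 i i≤
  ... | j , j≤ , e' = j , j≤ , trans e e'

  skipIndex : ℕ → ℕ → ℕ → ℕ
  skipIndex i d l with l ≤? i
  ... | yes _ = l
  ... | no _ = l + d

  skipIndex-lo : ∀ i d l → l ≤ i → skipIndex i d l ≡ l
  skipIndex-lo i d l h with l ≤? i
  ... | yes _ = refl
  ... | no ¬h = ⊥-elim (¬h h)

  skipIndex-hi : ∀ i d l → ¬ l ≤ i → skipIndex i d l ≡ l + d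
  skipIndex-hi i d l h with l ≤? i
  ... | yes q = ⊥-elim (h q)
  ... | no _ = refl

  skip : (P : Path X x y) (i d m' : ℕ) → m' + d ≡ m P →
         (suc i ≤ m' → adj X (p P i) (p P (suc i + d)) ≡ true) →
         (m' ≤ i → p P m' ≡ p P (m P)) →
         Σ (Path X x y) λ P' → m P' ≡ m' × VerticesWithin P' P
  skip P i d m' eq link end = mkP m' (λ l → p P (σ l)) q0 qm st , refl , within
    where
    σ : ℕ → ℕ
    σ = skipIndex i d
    lo : ∀ {l} → l ≤ i → σ l ≡ l
    lo = skipIndex-lo i d _
    hi : ∀ {l} → ¬ l ≤ i → σ l ≡ l + d
    hi = skipIndex-hi i d _
    q0 : p P (σ 0) ≡ x
    q0 = trans (cong (p P) (lo z≤n)) (p0 P)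
    qm : p P (σ m') ≡ y
    qm = byCase (m' ≤? i)
      where
      byCase : Dec (m' ≤ i) → p P (σ m') ≡ y
      byCase (yes h) = trans (cong (p P) (lo h)) (trans (end h) (pm P))
      byCase (no h) = trans (cong (p P) (trans (hi h) eq)) (pm P)
    st : ∀ l → l < m' → adj X (p P (σ l)) (p P (σ (suc l))) ≡ true
    st l l<m' with <-cmp l i
    ... | tri< l<i _ _ rewrite lo (<⇒≤ l<i) | lo l<i = stp P l (subst (l <_) eq (≤-trans l<m' (m≤m+n m' d)))
    ... | tri≈ _ refl _ rewrite lo (≤-refl {i}) | hi {suc i} (λ h → <-irrefl refl h) = link l<m'
    ... | tri> _ _ i<l rewrite hi (λ h → <-irrefl refl (<-≤-trans i<l h))
                             | hi {suc l} (λ h → <-irrefl refl (<-≤-trans i<l (≤-trans (n≤1+n l) h))) =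
          stp P (l + d) (subst (_ <_) eq (+-monoˡ-< d l<m'))
    within : VerticesWithin (mkP m' (λ l → p P (σ l)) q0 qm st) P
    within l l≤ = σ l , byCase (l ≤? i) , refl
      where
      byCase : Dec (l ≤ i) → σ l ≤ m P
      byCase (yes h) = subst (_≤ m P) (sym (lo h)) (≤-trans l≤ (subst (m' ≤_) eq (m≤m+n m' d)))
      byCase (no h) = subst (_≤ m P) (sym (hi h)) (subst (_ ≤_) eq (+-monoˡ-≤ d l≤))

  Defect : Path X x y → ℕ → ℕ → Set
  Defect P i j = p P i ≡ p P j ⊎ (suc i < j × adj X (p P i) (p P j) ≡ true)

  defect? : ∀ P i j → Dec (Defect P i j)
  defect? P i j = (p P i F.≟ p P j) ⊎-dec ((suc i <? j) ×-dec (adj X (p P i) (p P j) Bool.≟ true))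

  defectFree⇒induced : ∀ P → (∀ i j → i < j → j < suc (m P) → ¬ Defect P i j) → InducedPath P
  defectFree⇒induced P none = distinct , chordless
    where
    distinct : ∀ i j → i ≤ m P → j ≤ m P → p P i ≡ p P j → i ≡ j
    distinct i j i≤ j≤ e with <-cmp i j
    ... | tri< i<j _ _ = ⊥-elim (none i j i<j (s≤s j≤) (inj₁ e))
    ... | tri≈ _ q _ = q
    ... | tri> _ _ j<i = ⊥-elim (none j i j<i (s≤s i≤) (inj₁ (sym e)))
    chordless : ∀ i j → i ≤ m P → j ≤ m P → adj X (p P i) (p P j) ≡ true → suc i ≡ j ⊎ suc j ≡ i
    chordless i j i≤ j≤ a with <-cmp i j
    ... | tri< i<j _ _ with m≤n⇒m<n∨m≡n i<j
    ...   | inj₁ si<j = ⊥-elim (none i j i<j (s≤s j≤) (inj₂ (si<j , a)))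
    ...   | inj₂ q = inj₁ q
    chordless i j i≤ j≤ a | tri≈ _ refl _ = ⊥-elim (adj⇒≢ X a refl)
    chordless i j i≤ j≤ a | tri> _ _ j<i with m≤n⇒m<n∨m≡n j<i
    ...   | inj₁ sj<i = ⊥-elim (none j i j<i (s≤s i≤) (inj₂ (sj<i , adj-sym X a)))
    ...   | inj₂ q = inj₂ q

  skip-shorter : ∀ a d e' → 0 < d → ∀ {M} → a + d + e' ≡ M → a + e' < M
  skip-shorter a d e' 0<d eq = subst (a + e' <_) eq (+-monoˡ-< e' (m<m+n a 0<d))

  -- A defect can be removed, giving a shorter path on the same vertices: for
  -- a repeat p i = p j continue after position i with the path after j, for
  -- a chord continue from p i directly with p j.
  removeDefect : (P : Path X x y) → ∀ i j → i < j → j ≤ m P → Defect P i j →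
                 Σ (Path X x y) λ P' → m P' < m P × VerticesWithin P' P
  removeDefect P i j i<j j≤ (inj₁ e) with m≤n⇒∃[o]m+o≡n (<⇒≤ i<j) | m≤n⇒∃[o]m+o≡n j≤
  ... | d , ed | e' , ee = proj₁ res , subst (_< m P) (sym (proj₁ (proj₂ res))) lt , proj₂ (proj₂ res)
    where
    link : suc i ≤ i + e' → adj X (p P i) (p P (suc i + d)) ≡ true
    link h = subst₂ (λ z w → adj X z (p P w) ≡ true) (sym e) (sym (cong suc ed))
               (stp P j (subst (j <_) ee (m<m+n j (positive-summand i e' h))))
    end : i + e' ≤ i → p P (i + e') ≡ p P (m P)
    end h with a+b≤a i e' h
    ... | refl = trans (cong (p P) (+-identityʳ i)) (trans e (cong (p P) (trans (sym (+-identityʳ j)) ee)))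
    eq : i + d + e' ≡ m P
    eq = trans (cong (_+ e') ed) ee
    res : Σ (Path X x y) λ P' → m P' ≡ i + e' × VerticesWithin P' P
    res = skip P i d (i + e') (trans (swap+ i e' d) eq) link end
    lt : i + e' < m P
    lt = skip-shorter i d e' (positive-summand i d (subst (i <_) (sym ed) i<j)) eq
  removeDefect P i j i<j j≤ (inj₂ (si<j , a)) with m≤n⇒∃[o]m+o≡n (<⇒≤ si<j) | m≤n⇒∃[o]m+o≡n j≤
  ... | d , ed | e' , ee = proj₁ res , subst (_< m P) (sym (proj₁ (proj₂ res))) lt , proj₂ (proj₂ res)
    where
    link : suc i ≤ suc i + e' → adj X (p P i) (p P (suc i + d)) ≡ true
    link _ = subst (λ z → adj X (p P i) (p P z) ≡ true) (sym ed) a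
    end : suc i + e' ≤ i → p P (suc i + e') ≡ p P (m P)
    end h = ⊥-elim (<-irrefl refl (≤-trans (s≤s (m≤m+n i e')) h))
    eq : suc i + d + e' ≡ m P
    eq = trans (cong (_+ e') ed) ee
    res : Σ (Path X x y) λ P' → m P' ≡ suc i + e' × VerticesWithin P' P
    res = skip P i d (suc i + e') (trans (swap+ (suc i) e' d) eq) link end
    lt : suc i + e' < m P
    lt = skip-shorter (suc i) d e' (positive-summand (suc i) d (subst (suc i <_) (sym ed) si<j)) eq

  shortcut : (P : Path X x y) → Σ (Path X x y) λ P' → InducedPath P' × VerticesWithin P' P
  shortcut P = go (m P) P ≤-refl
    where
    go : (fuel : ℕ) (P : Path X x y) → m P ≤ fuel → Σ (Path X x y) λ P' → InducedPath P' × VerticesWithin P' P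
    go fuel P mf with pairBelow (suc (m P)) (defect? P)
    ... | inj₂ none = P , defectFree⇒induced P none , (λ l l≤ → l , l≤ , refl)
    ... | inj₁ (i , j , i<j , j<sm , defect) with removeDefect P i j i<j (s≤s⁻¹ j<sm) defect
    go zero P mf | inj₁ _ | P' , lt , _ = ⊥-elim (n≮0 (<-≤-trans lt mf))
    go (suc fuel) P mf | inj₁ _ | P' , lt , within with go fuel P' (s≤s⁻¹ (<-≤-trans lt mf))
    ... | P'' , induced , within' = P'' , induced , within-trans {P'' = P''} {P' = P'} {P = P} within' within

module PathOps {n} (X : Graph n) where
  open Path

  prepend : ∀ {x y} (c : Fin n) → adj X c x ≡ true → Path X x y → Path X c y
  prepend {x} {y} c a W = mkP (suc (m W)) q refl (pm W) st
    where
    q : ℕ → Fin n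
    q zero = c
    q (suc i) = p W i
    st : ∀ i → i < suc (m W) → adj X (q i) (q (suc i)) ≡ true
    st zero _ = subst (λ z → adj X c z ≡ true) (sym (p0 W)) a
    st (suc i) h = stp W i (s≤s⁻¹ h)

  prepend-all : ∀ {x y} (c : Fin n) (a : adj X c x ≡ true) (W : Path X x y) (Q : Fin n → Set) →
                Q c → (∀ i → i ≤ m W → Q (p W i)) → ∀ i → i ≤ m (prepend c a W) → Q (p (prepend c a W) i)
  prepend-all c a W Q qc h zero _ = qc
  prepend-all c a W Q qc h (suc i) le = h i (s≤s⁻¹ le)

  reverse : ∀ {x y} → Path X x y → Path X y x
  reverse {x} {y} W = mkP (m W) (λ i → p W (m W ∸ i)) (pm W) (trans (cong (p W) (n∸n≡0 (m W))) (p0 W)) st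
    where
    st : ∀ i → i < m W → adj X (p W (m W ∸ i)) (p W (m W ∸ suc i)) ≡ true
    st i h = adj-sym X (subst (λ z → adj X (p W (m W ∸ suc i)) (p W z) ≡ true) (sym (sub-suc (m W) i h))
               (stp W (m W ∸ suc i) (∸-monoʳ-< z<s h)))

  reverse-all : ∀ {x y} (W : Path X x y) (Q : Fin n → Set) → (∀ i → i ≤ m W → Q (p W i)) →
                ∀ i → i ≤ m (reverse W) → Q (p (reverse W) i)
  reverse-all W Q h i le = h (m W ∸ i) (m∸n≤m (m W) i)

  trivialPath : (c : Fin n) → Path X c c
  trivialPath c = mkP 0 (λ _ → c) refl refl (λ _ ())

module DeleteEdge {n} (G : Graph n) (s t : Fin n) where
  isST : Fin n → Fin n → Bool
  isST u v = (eqb u s ∧ eqb v t) ∨ (eqb u t ∧ eqb v s)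

  isST-sym : ∀ u v → isST u v ≡ isST v u
  isST-sym u v = trans (∨-comm (eqb u s ∧ eqb v t) (eqb u t ∧ eqb v s))
                       (cong₂ _∨_ (∧-comm (eqb u t) (eqb v s)) (∧-comm (eqb u s) (eqb v t)))

  isST-cases : ∀ {u v} → isST u v ≡ true → (u ≡ s × v ≡ t) ⊎ (u ≡ t × v ≡ s)
  isST-cases {u} {v} e with ∨-true e
  ... | inj₁ q = inj₁ (eqb-true (proj₁ (∧-true q)) , eqb-true (proj₂ (∧-true q)))
  ... | inj₂ q = inj₂ (eqb-true (proj₁ (∧-true q)) , eqb-true (proj₂ (∧-true q)))

  isST-ts : isST t s ≡ true
  isST-ts rewrite eqb-refl t | eqb-refl s = ∨-zeroʳ (eqb t s ∧ eqb s t)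

  G∖st : Graph n
  G∖st = record { adj = λ u v → adj G u v ∧ not (isST u v)
                ; sym = λ u v → cong₂ (λ a b → a ∧ not b) (Graph.sym G u v) (isST-sym u v)
                ; irrefl = λ u → cong (λ a → a ∧ not (isST u u)) (irrefl G u) }

  ∖⇒G : ∀ {u v} → adj G∖st u v ≡ true → adj G u v ≡ true
  ∖⇒G e = proj₁ (∧-true e)

  ∖⇒notST : ∀ {u v} → adj G∖st u v ≡ true → isST u v ≡ false
  ∖⇒notST {u} {v} e = not-true (proj₂ (∧-true {adj G u v} e))

  G⇒∖ : ∀ {u v} → adj G u v ≡ true → isST u v ≡ false → adj G∖st u v ≡ true
  G⇒∖ a e rewrite a | e = refl

  closeWithEdge : adj G s t ≡ true → ∀ L (V : Path G∖st t s) → Path.m V ≡ suc (suc L) → InducedPath V → IndexedCycle G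
  closeWithEdge st L (mkP .(suc (suc L)) q q0 qm steps) refl (distinct , chordless) = record
    { extra = L ; vertex = q
    ; vertex-inj = λ i j hi hj → distinct i j (s≤s⁻¹ hi) (s≤s⁻¹ hj)
    ; adj⇒cycAdj = adj⇒cyc ; cycAdj⇒adj = cyc⇒adj }
    where
    M : ℕ
    M = suc (suc L)
    adj⇒cyc : ∀ i j → i < 3 + L → j < 3 + L → adj G (q i) (q j) ≡ true → CycAdj (3 + L) i j
    adj⇒cyc i j hi hj ad with isST (q i) (q j) in eqST
    ... | true with isST-cases eqST
    ...   | inj₁ (qi , qj) = inj₂ (inj₂ (inj₂ (distinct j 0 (s≤s⁻¹ hj) z≤n (trans qj (sym q0)) ,
                                  cong suc (distinct i M (s≤s⁻¹ hi) ≤-refl (trans qi (sym qm))))))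
    ...   | inj₂ (qi , qj) = inj₂ (inj₂ (inj₁ (distinct i 0 (s≤s⁻¹ hi) z≤n (trans qi (sym q0)) ,
                                  cong suc (distinct j M (s≤s⁻¹ hj) ≤-refl (trans qj (sym qm))))))
    adj⇒cyc i j hi hj ad | false with chordless i j (s≤s⁻¹ hi) (s≤s⁻¹ hj) (G⇒∖ ad eqST)
    ... | inj₁ e = inj₁ e
    ... | inj₂ e = inj₂ (inj₁ e)
    cyc⇒adj : ∀ i j → i < 3 + L → j < 3 + L → CycAdj (3 + L) i j → adj G (q i) (q j) ≡ true
    cyc⇒adj i j hi hj (inj₁ refl) = ∖⇒G (steps i (s≤s⁻¹ hj))
    cyc⇒adj i j hi hj (inj₂ (inj₁ refl)) = adj-sym G (∖⇒G (steps j (s≤s⁻¹ hi)))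
    cyc⇒adj i j hi hj (inj₂ (inj₂ (inj₁ (refl , e)))) rewrite suc-injective e =
      subst₂ (λ x y → adj G x y ≡ true) (sym q0) (sym qm) (adj-sym G st)
    cyc⇒adj i j hi hj (inj₂ (inj₂ (inj₂ (refl , e)))) rewrite suc-injective e =
      subst₂ (λ x y → adj G x y ≡ true) (sym qm) (sym q0) st

module TriangleGraphChordal {n} (G : Graph n) (hyp : HoleUniqueEdgeProperty G) where
  open TriangleGraph G

  module CycleOfT (H : IndexedCycle T) where
    open IndexedCycle H renaming (extra to l; vertex to f; vertex-inj to f-inj; adj⇒cycAdj to f-adj; cycAdj⇒adj to f-cyc)

    k : ℕ
    k = 3 + l

    cycAdj⇒G : ∀ {i j} → i < k → j < k → CycAdj k i j → adj G (f i) (f j) ≡ true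
    cycAdj⇒G i< j< c = T⊆G (f-cyc _ _ i< j< c)

    -- Positions a < a + d < k with d ≥ 2, other than the pair {0 , k - 1},
    -- are not consecutive on H.  Here e + 1 counts the positions after a + d.
    notCycAdj : ∀ a d e → a + d + suc e ≡ k → 2 ≤ d → ¬ (a ≡ 0 × e ≡ 0) → ¬ CycAdj k a (a + d)
    notCycAdj a d e total d2 nw (inj₁ q) = <-irrefl q (subst (_≤ a + d) (a+2≡ a) (+-monoʳ-≤ a d2))
    notCycAdj a d e total d2 nw (inj₂ (inj₁ q)) = <-irrefl (sym q) (s≤s (m≤m+n a d))
    notCycAdj a d e total d2 nw (inj₂ (inj₂ (inj₁ (a0 , q)))) =
      nw (a0 , a+b≡a (a + d) e (suc-injective (trans (sym (+-suc (a + d) e)) (trans total (sym q)))))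
    notCycAdj a d e total d2 nw (inj₂ (inj₂ (inj₂ (q , _)))) = <-irrefl (sym q) (<-≤-trans z<s (≤-trans d2 (m≤n+m d a)))

    InnerChord : ℕ → ℕ → ℕ → ℕ → Set
    InnerChord a d a' b' = a ≤ a' × suc (suc a') ≤ b' × ¬ (a' ≡ a × b' ≡ a + d) × adj G (f a') (f b') ≡ true

    innerChord? : ∀ a d a' b' → Dec (InnerChord a d a' b')
    innerChord? a d a' b' = (a ≤? a') ×-dec ((suc (suc a') ≤? b') ×-dec
                            (¬? ((a' ≟ a) ×-dec (b' ≟ a + d)) ×-dec (adj G (f a') (f b') Bool.≟ true)))

    innerChord-shorter : ∀ {a d e a' b'} → a ≤ a' → suc (suc a') ≤ b' → b' < suc (a + d) → ¬ (a' ≡ a × b' ≡ a + d) →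
      a + d + suc e ≡ k → ¬ (a ≡ 0 × e ≡ 0) →
      ∃ λ d' → ∃ λ e' → a' + d' ≡ b' × a' + d' + suc e' ≡ k × 2 ≤ d' × d' < d × ¬ (a' ≡ 0 × e' ≡ 0)
    innerChord-shorter {a} {d} {e} {a'} {b'} aa ss bl ne total nw with m≤n⇒∃[o]m+o≡n ss | m≤n⇒∃[o]m+o≡n (≤-<-trans (s≤s⁻¹ bl) (subst (a + d <_) total (lt-sum (a + d) e)))
    ... | x , ex | e' , ee = suc (suc x) , e' , ab , total' , s≤s (s≤s z≤n) , shorter , nw'
      where
      b≤ : b' ≤ a + d
      b≤ = s≤s⁻¹ bl
      ab : a' + suc (suc x) ≡ b'
      ab = trans (+-suc-suc a' x) ex
      total' : a' + suc (suc x) + suc e' ≡ k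
      total' = trans (cong (_+ suc e') ab) (trans (+-suc b' e') ee)
      shorter : suc (suc x) < d
      shorter with suc (suc x) <? d
      ... | yes q = q
      ... | no q = ⊥-elim (ne (a'≡a , trans (sym ab) same))
        where
        same : a' + suc (suc x) ≡ a + d
        same = ≤-antisym (subst (_≤ a + d) (sym ab) b≤) (+-mono-≤ aa (≮⇒≥ q))
        a'≡a : a' ≡ a
        a'≡a = ≤-antisym (+-cancelʳ-≤ (suc (suc x)) a' a (≤-trans (≤-reflexive same) (+-monoʳ-≤ a (≮⇒≥ q)))) aa
      nw' : ¬ (a' ≡ 0 × e' ≡ 0)
      nw' (a'0 , e'0) = nw (a0 , a+b≤a (a + d) e (s≤s⁻¹ k≤))
        where
        a0 : a ≡ 0
        a0 = ≤-antisym (subst (a ≤_) a'0 aa) z≤n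
        kb : k ≡ suc b'
        kb = trans (sym ee) (trans (cong (suc b' +_) e'0) (cong suc (+-identityʳ b')))
        k≤ : suc (a + d + e) ≤ suc (a + d)
        k≤ = subst (_≤ suc (a + d)) (trans (sym kb) (trans (sym total) (+-suc (a + d) e))) (s≤s b≤)

    -- A chord (a , a + d) of H with d ≥ 3 and no inner chord leads to a
    -- contradiction: the arc a … a + d closed by the chord is a hole C of G,
    -- and no edge of C can be its edge e_C.
    module ChordlessArc (a L' e : ℕ) (total : a + suc (suc (suc L')) + suc e ≡ k) (nw : ¬ (a ≡ 0 × e ≡ 0))
                        (chord : adj G (f a) (f (a + suc (suc (suc L')))) ≡ true)
                        (noInner : ∀ a' b' → a' < b' → b' < suc (a + suc (suc (suc L'))) →
                                   ¬ InnerChord a (suc (suc (suc L'))) a' b') where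
      d : ℕ
      d = suc (suc (suc L'))

      ad<k : a + d < k
      ad<k = subst (a + d <_) total (lt-sum (a + d) e)

      a<k : a < k
      a<k = ≤-<-trans (m≤m+n a d) ad<k

      onArc : ∀ j → j < suc d → a + j < k
      onArc j j< = ≤-<-trans (+-monoʳ-≤ a (s≤s⁻¹ j<)) ad<k

      g : ℕ → Fin n
      g j = f (a + j)

      arc-ordered : ∀ i j → i < j → j < suc d → adj G (g i) (g j) ≡ true → suc i ≡ j ⊎ (i ≡ 0 × suc j ≡ suc d)
      arc-ordered i j i<j j< aij with m≤n⇒m<n∨m≡n i<j
      ... | inj₂ q = inj₁ q
      ... | inj₁ si<j with (i ≟ 0) ×-dec (j ≟ d)
      ...   | yes (i0 , jd) = inj₂ (i0 , cong suc jd)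
      ...   | no w = ⊥-elim (noInner (a + i) (a + j) (+-monoʳ-< a i<j) (subst (a + j <_) (+-suc a d) (+-monoʳ-< a j<))
                       (m≤m+n a i , subst (_≤ a + j) (+-suc-suc a i) (+-monoʳ-≤ a si<j) , ne , aij))
        where
        ne : ¬ (a + i ≡ a × a + j ≡ a + d)
        ne (p , q) = w (a+b≡a a i p , +-cancelˡ-≡ a j d q)

      chord₀ : adj G (g 0) (g d) ≡ true
      chord₀ = subst (λ z → adj G (f z) (f (a + d)) ≡ true) (sym (+-identityʳ a)) chord

      arc-cyc⇒adj : ∀ i j → i < suc d → j < suc d → CycAdj (suc d) i j → adj G (g i) (g j) ≡ true
      arc-cyc⇒adj i j hi hj (inj₁ q) = cycAdj⇒G (onArc i hi) (onArc j hj) (inj₁ (trans (sym (+-suc a i)) (cong (a +_) q)))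
      arc-cyc⇒adj i j hi hj (inj₂ (inj₁ q)) = cycAdj⇒G (onArc i hi) (onArc j hj) (inj₂ (inj₁ (trans (sym (+-suc a j)) (cong (a +_) q))))
      arc-cyc⇒adj i j hi hj (inj₂ (inj₂ (inj₁ (refl , q)))) rewrite suc-injective q = chord₀
      arc-cyc⇒adj i j hi hj (inj₂ (inj₂ (inj₂ (refl , q)))) rewrite suc-injective q = adj-sym G chord₀

      arcCycle : IndexedCycle G
      arcCycle = record
        { extra = suc L' ; vertex = g
        ; vertex-inj = λ i j hi hj eq → +-cancelˡ-≡ a i j (f-inj (a + i) (a + j) (onArc i hi) (onArc j hj) eq)
        ; adj⇒cycAdj = ordered⇒cycAdj G g (suc d) arc-ordered ; cycAdj⇒adj = arc-cyc⇒adj }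

      C : InducedCycle G
      C = toInducedCycle arcCycle

      fa fb : Fin n
      fa = f a
      fb = f (a + d)

      open DeleteEdge G fa fb

      -- The complementary arc a + d, a + d + 1, …, k - 1, 0, 1, …, a of H,
      -- indexed by i ≤ e + 1 + a.
      wi : ℕ → ℕ
      wi i with i ≤? e
      ... | yes _ = a + d + i
      ... | no _ = i ∸ suc e

      wi-lo : ∀ i → i ≤ e → wi i ≡ a + d + i
      wi-lo i h with i ≤? e
      ... | yes _ = refl
      ... | no ¬h = ⊥-elim (¬h h)

      wi-hi : ∀ t → wi (suc e + t) ≡ t
      wi-hi t with suc e + t ≤? e
      ... | yes h = ⊥-elim (<-irrefl refl (≤-trans (s≤s (m≤m+n e t)) h))
      ... | no _ = m+n∸m≡n (suc e) t

      view : ∀ i → i ≤ e ⊎ (∃ λ t → suc e + t ≡ i)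
      view i with i ≤? e
      ... | yes h = inj₁ h
      ... | no h = inj₂ (m≤n⇒∃[o]m+o≡n (≰⇒> h))

      wi-bound : ∀ i → i ≤ suc e + a → wi i < k
      wi-bound i i≤ with view i
      ... | inj₁ h = subst (_< k) (sym (wi-lo i h)) (subst (a + d + i <_) total (+-monoʳ-< (a + d) (s≤s h)))
      ... | inj₂ (t , refl) = subst (_< k) (sym (wi-hi t)) (≤-<-trans (+-cancelˡ-≤ (suc e) t a i≤) a<k)

      wi-step : ∀ i → i < suc e + a → CycAdj k (wi i) (wi (suc i))
      wi-step i i< with view i
      ... | inj₂ (t , refl) = subst₂ (CycAdj k) (sym (wi-hi t)) (sym w2) (inj₁ refl)
        where
        w2 : wi (suc (suc e + t)) ≡ suc t
        w2 = trans (cong wi (sym (+-suc (suc e) t))) (wi-hi (suc t))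
      ... | inj₁ h with m≤n⇒m<n∨m≡n h
      ...   | inj₁ i<e = subst₂ (CycAdj k) (sym (wi-lo i h)) (sym (wi-lo (suc i) i<e)) (inj₁ (sym (+-suc (a + d) i)))
      ...   | inj₂ refl = subst₂ (CycAdj k) (sym (wi-lo i h)) (sym w0) (inj₂ (inj₂ (inj₂ (refl , trans (sym (+-suc (a + d) i)) total))))
        where
        w0 : wi (suc i) ≡ 0
        w0 = trans (cong wi (cong suc (sym (+-identityʳ i)))) (wi-hi 0)

      wi-notChord : ∀ i → i < suc e + a → isST (f (wi i)) (f (wi (suc i))) ≡ false
      wi-notChord i i< with isST (f (wi i)) (f (wi (suc i))) in eqST
      ... | false = refl
      ... | true with isST-cases eqST
      ...   | inj₁ (p , q) = ⊥-elim (notCycAdj a d e total (s≤s (s≤s z≤n)) nw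
                (subst₂ (CycAdj k) (f-inj _ _ (wi-bound i (<⇒≤ i<)) a<k p) (f-inj _ _ (wi-bound (suc i) i<) ad<k q) (wi-step i i<)))
      ...   | inj₂ (p , q) = ⊥-elim (notCycAdj a d e total (s≤s (s≤s z≤n)) nw (CycAdj-sym
                (subst₂ (CycAdj k) (f-inj _ _ (wi-bound i (<⇒≤ i<)) ad<k p) (f-inj _ _ (wi-bound (suc i) i<) a<k q) (wi-step i i<))))

      complement : Path G∖st fb fa
      complement = mkP (suc e + a) (λ i → f (wi i))
                     (cong f (trans (wi-lo 0 z≤n) (+-identityʳ (a + d))))
                     (cong f (wi-hi a))
                     (λ i i< → G⇒∖ (cycAdj⇒G (wi-bound i (<⇒≤ i<)) (wi-bound (suc i) i<) (wi-step i i<)) (wi-notChord i i<))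

      -- Strictly inside the complementary arc lie only vertices f j with
      -- j < a or j > a + d, so none of them is a vertex of C.
      interior-offArc : ∀ t → t ≤ suc e + a → t ≢ 0 → t ≢ suc e + a → ∀ r → r < suc d → a + r ≢ wi t
      interior-offArc t t≤ t≢0 t≢end r r< eq with view t
      ... | inj₁ h = <-irrefl eq (≤-<-trans (+-monoʳ-≤ a (s≤s⁻¹ r<))
                       (subst (a + d <_) (sym (wi-lo t h)) (subst (_< a + d + t) (+-identityʳ (a + d))
                         (+-monoʳ-< (a + d) (≤∧≢⇒< z≤n (λ q → t≢0 (sym q)))))))
      ... | inj₂ (t' , et') = <-irrefl (sym (trans eq (trans (cong wi (sym et')) (wi-hi t')))) (≤-trans t'<a (m≤m+n a r))
        where
        t'<a : t' < a
        t'<a = ≤∧≢⇒< (+-cancelˡ-≤ (suc e) t' a (subst (_≤ suc e + a) (sym et') t≤))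
                     (λ q → t≢end (trans (sym et') (cong (suc e +_) q)))

      -- e_C is not the chord: the induced path inside the complementary arc
      -- closes the chord into a second induced cycle through it.
      chord-notUnique : (∀ D → EdgeOf fb fa D → SameCycle C D) → ⊥
      chord-notUnique unique with shortcut complement
      ... | mkP zero q q0 qm _ , _ , _ =
        <-irrefl (sym (a+b≡a a d (sym (f-inj _ _ a<k ad<k (trans (sym qm) q0))))) z<s
      ... | mkP (suc zero) q q0 qm steps , _ , _ =
        t≢f (trans (sym isST-ts) (subst₂ (λ x y → isST x y ≡ false) q0 qm (∖⇒notST (steps 0 z<s))))
      ... | V@(mkP (suc (suc L2)) q q0 qm steps) , induced@(distinct , _) , within = secondVertex-offArc
        where
        D : InducedCycle G
        D = toInducedCycle (closeWithEdge chord L2 V refl induced)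
        last : Fin (3 + L2)
        last = fromℕ< {suc (suc L2)} ≤-refl
        toℕ-last : toℕ last ≡ suc (suc L2)
        toℕ-last = toℕ-fromℕ< {suc (suc L2)} {3 + L2} ≤-refl
        chordOfD : EdgeOf fb fa D
        chordOfD = last , inj₂ (trans (cong q toℕ-last) qm ,
                                trans (cong q (cnext-ge last (λ h → <-irrefl (cong suc toℕ-last) h))) q0)
        -- q 1 is a vertex of D, hence of C, but it lies strictly inside the
        -- complementary arc
        inC : ∃[ r ] g (toℕ r) ≡ q 1
        inC = Equivalence.from (unique D chordOfD (q 1)) (fromℕ< {1} (s≤s (s≤s z≤n)) , refl)
        secondVertex-offArc : ⊥
        secondVertex-offArc with within 1 (s≤s z≤n)
        ... | t , t≤ , et = interior-offArc t t≤ t≢0 t≢end (toℕ r) (toℕ<n r)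
                              (f-inj _ _ (onArc (toℕ r) (toℕ<n r)) (wi-bound t t≤) (trans (proj₂ inC) et))
          where
          r : Fin (3 + suc L')
          r = proj₁ inC
          t≢0 : t ≢ 0
          t≢0 t0 with distinct 1 0 (s≤s z≤n) z≤n (trans et (trans (cong (λ z → f (wi z)) t0) (trans (Path.p0 complement) (sym q0))))
          ... | ()
          t≢end : t ≢ suc e + a
          t≢end tL with distinct 1 (suc (suc L2)) (s≤s z≤n) ≤-refl (trans et (trans (cong (λ z → f (wi z)) tL) (trans (Path.pm complement) (sym qm))))
          ... | ()

      -- Every edge of C is either an edge of H (a T-edge) or the chord.
      contradiction : ⊥
      contradiction with hyp C (λ ())
      ... | r , unique = byEdge (suc (toℕ r) <? suc d)
        where
        byEdge : Dec (suc (toℕ r) < suc d) → ⊥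
        byEdge (yes q) = uniqueEdge-notInTriangle C (λ ()) r unique
          (subst (λ z → tadj (g (toℕ r)) (g z) ≡ true) (sym (cnext-lt r q))
            (f-cyc (a + toℕ r) (a + suc (toℕ r)) (onArc _ (toℕ<n r)) (onArc _ q) (inj₁ (sym (+-suc a (toℕ r))))))
        byEdge (no q) = chord-notUnique λ D e → unique D (subst₂ (λ x y → EdgeOf x y D) (sym e1) (sym e2) e)
          where
          e1 : g (toℕ r) ≡ f (a + d)
          e1 = cong g (suc-injective (sucEq (toℕ<n r) q))
          e2 : g (toℕ (cnext r)) ≡ f a
          e2 = trans (cong g (cnext-ge r q)) (cong f (+-identityʳ a))

    -- No chord of H exists, by induction on the length d of its arc: an
    -- inner chord has a shorter arc; a chord without inner chord has d ≥ 3
    -- by `ChordlessArc`, or d = 2, when the chord lies in a triangle with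
    -- the middle vertex and would be an edge of T.
    NoChordOfSpan : ℕ → Set
    NoChordOfSpan d = ∀ a e → a + d + suc e ≡ k → 2 ≤ d → ¬ (a ≡ 0 × e ≡ 0) → adj G (f a) (f (a + d)) ≡ true → ⊥

    noChord : ∀ d → NoChordOfSpan d
    noChord = <-rec NoChordOfSpan byLength
      where
      byLength : ∀ d → (∀ {d'} → d' < d → NoChordOfSpan d') → NoChordOfSpan d
      byLength 0 _ a e _ () _ _
      byLength 1 _ a e _ (s≤s ()) _ _
      byLength 2 _ a e total d2 nw ch = notCycAdj a 2 e total d2 nw (f-adj a (a + 2) a<k b<k triangleEdge)
        where
        b<k : a + 2 < k
        b<k = subst (a + 2 <_) total (lt-sum (a + 2) e)
        a1<k : suc a < k
        a1<k = <-trans (subst (suc a <_) (sym (a+2≡ a)) ≤-refl) b<k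
        a<k : a < k
        a<k = <-trans ≤-refl a1<k
        triangleEdge : tadj (f a) (f (a + 2)) ≡ true
        triangleEdge = triangle⇒T ch (cycAdj⇒G a<k a1<k (inj₁ refl)) (cycAdj⇒G b<k a1<k (inj₂ (inj₁ (sym (a+2≡ a)))))
      byLength d@(suc (suc (suc L'))) shorter a e total d2 nw ch
        with pairBelow (suc (a + d)) (innerChord? a d)
      ... | inj₂ none = ChordlessArc.contradiction a L' e total nw ch none
      ... | inj₁ (a' , b' , _ , bl , aa , ss , ne , ch') with innerChord-shorter aa ss bl ne total nw
      ...   | d' , e' , ab , total' , d'2 , d'<d , nw' =
              shorter d'<d a' e' total' d'2 nw' (subst (λ z → adj G (f a') (f z) ≡ true) (sym ab) ch')

    -- A chordless H is itself a hole of G all of whose edges lie in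
    -- triangles, which the hypothesis forbids.
    chordless-notHole : (∀ i j → i < j → j < k → ¬ (suc (suc i) ≤ j × ¬ (i ≡ 0 × suc j ≡ k) × adj G (f i) (f j) ≡ true)) →
                        l ≢ 0 → ⊥
    chordless-notHole none hl = uniqueEdge-notInTriangle C hl r unique
      (f-cyc _ _ (toℕ<n r) (toℕ<n (cnext r)) (cnext⇒CycAdj r (cnext r) refl))
      where
      ordered : ∀ i j → i < j → j < k → adj G (f i) (f j) ≡ true → suc i ≡ j ⊎ (i ≡ 0 × suc j ≡ k)
      ordered i j i<j j< aij with m≤n⇒m<n∨m≡n i<j
      ... | inj₂ q = inj₁ q
      ... | inj₁ si<j with (i ≟ 0) ×-dec (suc j ≟ k)
      ...   | yes ends = inj₂ ends
      ...   | no w = ⊥-elim (none i j i<j j< (si<j , w , aij))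
      C : InducedCycle G
      C = toInducedCycle (record { extra = l ; vertex = f ; vertex-inj = f-inj
                                 ; adj⇒cycAdj = ordered⇒cycAdj G f k ordered ; cycAdj⇒adj = λ i j hi hj → cycAdj⇒G hi hj })
      r : Fin (3 + l)
      r = proj₁ (hyp C hl)
      unique : ∀ D → EdgeOf (vert C r) (vert C (cnext r)) D → SameCycle C D
      unique = proj₂ (hyp C hl)

    noHole : l ≢ 0 → ⊥
    noHole hl with pairBelow k (λ i j → (suc (suc i) ≤? j) ×-dec (¬? ((i ≟ 0) ×-dec (suc j ≟ k)) ×-dec (adj G (f i) (f j) Bool.≟ true)))
    ... | inj₂ none = chordless-notHole none hl
    ... | inj₁ (a , b , _ , b<k , ss , nwb , ch) with m≤n⇒∃[o]m+o≡n ss | m≤n⇒∃[o]m+o≡n b<k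
    ...   | x , ex | e , ee = noChord (suc (suc x)) a e total (s≤s (s≤s z≤n)) nw (subst (λ z → adj G (f a) (f z) ≡ true) (sym ab) ch)
      where
      ab : a + suc (suc x) ≡ b
      ab = trans (+-suc-suc a x) ex
      total : a + suc (suc x) + suc e ≡ k
      total = trans (cong (_+ suc e) ab) (trans (+-suc b e) ee)
      nw : ¬ (a ≡ 0 × e ≡ 0)
      nw (a0 , e0) = nwb (a0 , trans (cong suc (sym (+-identityʳ b))) (trans (cong (suc b +_) (sym e0)) ee))

  triangleGraph-chordal : (H : IndexedCycle T) → IndexedCycle.extra H ≢ 0 → ⊥
  triangleGraph-chordal H = CycleOfT.noHole H

module CycleFromPath {n} (X : Graph n) {c q : Fin n} (P : Path X c q) (induced : InducedPath P)
    (s t : Fin n) (s-off : ∀ l → l ≤ Path.m P → s ≢ Path.p P l) (t-off : ∀ l → l ≤ Path.m P → t ≢ Path.p P l)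
    (s≢t : s ≢ t) (st : adj X s t ≡ true)
    (i L : ℕ) (iL : i + suc L ≡ Path.m P)
    (si : adj X s (Path.p P i) ≡ true)
    (s-last : ∀ j → i < j → j ≤ Path.m P → ¬ (adj X s (Path.p P j) ≡ true))
    (t-end : ∀ l → l < Path.m P → adj X t (Path.p P l) ≡ false)
    (tq : adj X t (Path.p P (Path.m P)) ≡ true) where
  open Path P renaming (p to pp; m to mP)
  distinct : ∀ i j → i ≤ mP → j ≤ mP → pp i ≡ pp j → i ≡ j
  distinct = proj₁ induced
  chordless : ∀ i j → i ≤ mP → j ≤ mP → adj X (pp i) (pp j) ≡ true → suc i ≡ j ⊎ suc j ≡ i
  chordless = proj₂ induced

  hf : ℕ → Fin n
  hf zero = s
  hf (suc r) with r ≤? suc L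
  ... | yes _ = pp (i + r)
  ... | no _ = t

  hf-p : ∀ r → r ≤ suc L → hf (suc r) ≡ pp (i + r)
  hf-p r h with r ≤? suc L
  ... | yes _ = refl
  ... | no ¬h = ⊥-elim (¬h h)

  hf-t : hf (3 + L) ≡ t
  hf-t with suc (suc L) ≤? suc L
  ... | yes h = ⊥-elim (<-irrefl refl h)
  ... | no _ = refl

  data View : ℕ → Set where
    v0 : View 0
    vp : ∀ r → r ≤ suc L → View (suc r)
    vt : View (3 + L)

  view : ∀ a → a < 4 + L → View a
  view zero _ = v0
  view (suc r) h with r ≤? suc L
  ... | yes q = vp r q
  ... | no q with ≤-antisym (s≤s⁻¹ (s≤s⁻¹ h)) (≰⇒> q)
  ... | refl = vt

  ir≤ : ∀ r → r ≤ suc L → i + r ≤ mP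
  ir≤ r h = subst (i + r ≤_) iL (+-monoʳ-≤ i h)

  L-eq : ∀ r → r ≤ suc L → i + r ≡ mP → r ≡ suc L
  L-eq r h e = +-cancelˡ-≡ i r (suc L) (trans e (sym iL))

  hf-inj : ∀ a b → a < 4 + L → b < 4 + L → hf a ≡ hf b → a ≡ b
  hf-inj a b ha hb e = go (view a ha) (view b hb) e
    where
    go : ∀ {a b} → View a → View b → hf a ≡ hf b → a ≡ b
    go v0 v0 e = refl
    go v0 (vp r h) e = ⊥-elim (s-off (i + r) (ir≤ r h) (trans e (hf-p r h)))
    go v0 vt e = ⊥-elim (s≢t (trans e hf-t))
    go (vp r h) v0 e = ⊥-elim (s-off (i + r) (ir≤ r h) (trans (sym e) (hf-p r h)))
    go (vp r h) (vp r' h') e =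
      cong suc (+-cancelˡ-≡ i r r' (distinct _ _ (ir≤ r h) (ir≤ r' h') (trans (sym (hf-p r h)) (trans e (hf-p r' h')))))
    go (vp r h) vt e = ⊥-elim (t-off (i + r) (ir≤ r h) (trans (sym hf-t) (trans (sym e) (hf-p r h))))
    go vt v0 e = ⊥-elim (s≢t (trans (sym e) hf-t))
    go vt (vp r h) e = ⊥-elim (t-off (i + r) (ir≤ r h) (trans (sym hf-t) (trans e (hf-p r h))))
    go vt vt e = refl

  s-sees : ∀ r → r ≤ suc L → adj X s (hf (suc r)) ≡ true → r ≡ 0
  s-sees zero h ad = refl
  s-sees (suc r) h ad = ⊥-elim (s-last (i + suc r) (subst (i <_) (sym (+-suc i r)) (s≤s (m≤m+n i r))) (ir≤ (suc r) h)
                                 (trans (cong (adj X s) (sym (hf-p (suc r) h))) ad))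

  t-sees : ∀ r → r ≤ suc L → adj X t (hf (suc r)) ≡ true → r ≡ suc L
  t-sees r h ad with m≤n⇒m<n∨m≡n (ir≤ r h)
  ... | inj₁ lt = ⊥-elim (t≢f (trans (sym (trans (cong (adj X t) (sym (hf-p r h))) ad)) (t-end (i + r) lt)))
  ... | inj₂ e = L-eq r h e

  hf-adj⇒ : ∀ a b → a < 4 + L → b < 4 + L → adj X (hf a) (hf b) ≡ true → CycAdj (4 + L) a b
  hf-adj⇒ a b ha hb ad = go (view a ha) (view b hb) ad
    where
    go : ∀ {a b} → View a → View b → adj X (hf a) (hf b) ≡ true → CycAdj (4 + L) a b
    go v0 v0 ad = ⊥-elim (adj⇒≢ X ad refl)
    go v0 (vp r h) ad with s-sees r h ad
    ... | refl = inj₁ refl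
    go v0 vt ad = inj₂ (inj₂ (inj₁ (refl , refl)))
    go (vp r h) v0 ad with s-sees r h (adj-sym X ad)
    ... | refl = inj₂ (inj₁ refl)
    go (vp r h) (vp r' h') ad with chordless (i + r) (i + r') (ir≤ r h) (ir≤ r' h')
                                         (subst₂ (λ x y → adj X x y ≡ true) (hf-p r h) (hf-p r' h') ad)
    ... | inj₁ e = inj₁ (cong suc (+-cancelˡ-≡ i (suc r) r' (trans (+-suc i r) e)))
    ... | inj₂ e = inj₂ (inj₁ (cong suc (+-cancelˡ-≡ i (suc r') r (trans (+-suc i r') e))))
    go (vp r h) vt ad with t-sees r h (subst (λ z → adj X z (hf (suc r)) ≡ true) hf-t (adj-sym X ad))
    ... | refl = inj₁ refl
    go vt v0 ad = inj₂ (inj₂ (inj₂ (refl , refl)))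
    go vt (vp r h) ad with t-sees r h (subst (λ z → adj X z (hf (suc r)) ≡ true) hf-t ad)
    ... | refl = inj₂ (inj₁ refl)
    go vt vt ad = ⊥-elim (adj⇒≢ X ad refl)

  s-first : ∀ r → r ≤ suc L → CycAdj (4 + L) 0 (suc r) → adj X s (hf (suc r)) ≡ true
  s-first r h (inj₁ refl) = trans (cong (adj X s) (hf-p 0 h)) (subst (λ z → adj X s (pp z) ≡ true) (sym (+-identityʳ i)) si)
  s-first r h (inj₂ (inj₂ (inj₁ (_ , e)))) = ⊥-elim (<-irrefl (suc-injective (suc-injective e)) (s≤s h))

  t-last : ∀ r → r ≤ suc L → CycAdj (4 + L) (suc r) (3 + L) → adj X (hf (suc r)) t ≡ true
  t-last r h (inj₁ e) with suc-injective (suc-injective e)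
  ... | refl = trans (cong (λ z → adj X z t) (hf-p (suc L) h)) (subst (λ z → adj X (pp z) t ≡ true) (sym iL) (adj-sym X tq))
  t-last r h (inj₂ (inj₁ e)) = ⊥-elim (<-irrefl (sym (suc-injective e)) (s≤s (m≤n⇒m≤1+n h)))
  t-last r h (inj₂ (inj₂ (inj₁ (() , _))))
  t-last r h (inj₂ (inj₂ (inj₂ (() , _))))

  path-step : ∀ r → suc r ≤ suc L → adj X (hf (suc r)) (hf (suc (suc r))) ≡ true
  path-step r h = subst₂ (λ x y → adj X x y ≡ true) (sym (hf-p r (<⇒≤ h))) (sym (trans (hf-p (suc r) h) (cong pp (+-suc i r))))
                    (stp (i + r) (subst (i + r <_) iL (+-monoʳ-< i h)))

  hf-adj⇐ : ∀ a b → a < 4 + L → b < 4 + L → CycAdj (4 + L) a b → adj X (hf a) (hf b) ≡ true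
  hf-adj⇐ a b ha hb c = go (view a ha) (view b hb) c
    where
    go : ∀ {a b} → View a → View b → CycAdj (4 + L) a b → adj X (hf a) (hf b) ≡ true
    go v0 v0 (inj₁ ())
    go v0 v0 (inj₂ (inj₁ ()))
    go v0 v0 (inj₂ (inj₂ (inj₁ (_ , ()))))
    go v0 v0 (inj₂ (inj₂ (inj₂ (_ , ()))))
    go v0 (vp r h) c = s-first r h c
    go v0 vt c = trans (cong (adj X s) hf-t) st
    go (vp r h) v0 c = adj-sym X (s-first r h (CycAdj-sym c))
    go (vp r h) (vp r' h') (inj₁ e) with suc-injective e
    ... | refl = path-step r h'
    go (vp r h) (vp r' h') (inj₂ (inj₁ e)) with suc-injective e
    ... | refl = adj-sym X (path-step r' h)
    go (vp r h) (vp r' h') (inj₂ (inj₂ (inj₁ (() , _))))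
    go (vp r h) (vp r' h') (inj₂ (inj₂ (inj₂ (() , _))))
    go (vp r h) vt c = subst (λ z → adj X (hf (suc r)) z ≡ true) (sym hf-t) (t-last r h c)
    go vt v0 c = adj-sym X (trans (cong (adj X s) hf-t) st)
    go vt (vp r h) c = adj-sym X (subst (λ z → adj X (hf (suc r)) z ≡ true) (sym hf-t) (t-last r h (CycAdj-sym c)))
    go vt vt (inj₁ e) = ⊥-elim (<-irrefl (sym e) ≤-refl)
    go vt vt (inj₂ (inj₁ e)) = ⊥-elim (<-irrefl (sym e) ≤-refl)
    go vt vt (inj₂ (inj₂ (inj₁ (() , _))))
    go vt vt (inj₂ (inj₂ (inj₂ (() , _))))

  cycle : IndexedCycle X
  cycle = record { extra = suc L ; vertex = hf ; vertex-inj = hf-inj ; adj⇒cycAdj = hf-adj⇒ ; cycAdj⇒adj = hf-adj⇐ }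

-- Maximum cardinality search on T.  A partial numbering is a map pos with
-- the numbered vertices being those with pos u < k.
module MaximumCardinalitySearch {n} (G : Graph n) (hyp : HoleUniqueEdgeProperty G) where
  open TriangleGraph G
  open TriangleGraphChordal G hyp

  Unnumbered : ℕ → (Fin n → ℕ) → ∀ {x y} → Path T x y → Set
  Unnumbered k pos W = ∀ i → i ≤ Path.m W → k ≤ pos (Path.p W i)

  MCSInvariant : ℕ → (Fin n → ℕ) → Set
  MCSInvariant k pos = ∀ x y (W : Path T x y) → Unnumbered k pos W → ∀ s t → pos s < k → pos t < k →
                       tadj s x ≡ true → tadj t y ≡ true → s ≡ t ⊎ tadj s t ≡ true

  numbered : ℕ → (Fin n → ℕ) → Fin n → Bool
  numbered k pos s = does (pos s <? k)

  weight : ℕ → (Fin n → ℕ) → Fin n → ℕ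
  weight k pos c = countFin (λ s → numbered k pos s ∧ tadj s c)

  numbered-off : ∀ {k pos s x y} (W : Path T x y) → Unnumbered k pos W → pos s < k → ∀ l → l ≤ Path.m W → s ≢ Path.p W l
  numbered-off {k} {pos} W out sin l l≤ refl = <-irrefl refl (<-≤-trans sin (out l l≤))

  -- Let P be an unnumbered induced T-path from c to q, and t a numbered
  -- vertex T-adjacent to q but to no other vertex of P.  Then every numbered
  -- T-neighbour s ≠ t of c is a T-neighbour of q: otherwise s, the part of P
  -- after the last T-neighbour of s, and t form a hole of T.
  neighbour-reaches-end : ∀ k pos → MCSInvariant k pos → ∀ {c q} (P : Path T c q) → InducedPath P →
    Unnumbered k pos P → ∀ t → pos t < k → (∀ l → l < Path.m P → tadj t (Path.p P l) ≡ false) → tadj t q ≡ true →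
    ∀ s → pos s < k → s ≢ t → tadj s c ≡ true → tadj s q ≡ true
  neighbour-reaches-end k pos inv {c} {q} P induced out t tin t-end tq s sin s≢t sc
    with inv c q P out s t sin tin sc tq
  ... | inj₁ s≡t = ⊥-elim (s≢t s≡t)
  ... | inj₂ st with greatestUpTo (Path.m P) (λ i → tadj s (Path.p P i) Bool.≟ true) (trans (cong (tadj s) (Path.p0 P)) sc)
  ...   | i , i≤ , si , s-last with m≤n⇒m<n∨m≡n i≤
  ...     | inj₂ refl = trans (cong (tadj s) (sym (Path.pm P))) si
  ...     | inj₁ i<m with m≤n⇒∃[o]m+o≡n i<m
  ...       | L , iL = ⊥-elim (triangleGraph-chordal hole (λ ()))
    where
    hole : IndexedCycle T
    hole = CycleFromPath.cycle T P induced s t (numbered-off P out sin) (numbered-off P out tin) s≢t st i L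
             (trans (+-suc i L) iL) si s-last t-end (trans (cong (tadj t) (Path.pm P)) tq)

  -- Otherwise take the
  -- first vertex q of the path seen by t and an induced path from c to q
  -- inside it: q sees all numbered T-neighbours of c and also t, so it has
  -- larger weight than c.
  mcs-key : ∀ k pos → MCSInvariant k pos → ∀ c → (∀ d → k ≤ pos d → weight k pos d ≤ weight k pos c) →
            ∀ t y (W : Path T c y) → Unnumbered k pos W → pos t < k → tadj t y ≡ true → tadj t c ≡ true
  mcs-key k pos inv c maximal t y W out tin ty with tadj t c in tc
  ... | true = refl
  ... | false with leastBelow (suc (Path.m W)) (λ i → tadj t (Path.p W i) Bool.≟ true)
  ...   | inj₂ none = ⊥-elim (none (Path.m W) ≤-refl (trans (cong (tadj t) (Path.pm W)) ty))
  ...   | inj₁ (j , j<sm , tj , least) with shortcut (mkP j (Path.p W) (Path.p0 W) refl (λ i i<j → Path.stp W i (<-≤-trans i<j (s≤s⁻¹ j<sm))))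
  ...     | P , induced@(distinct , _) , within = ⊥-elim (<-irrefl refl (<-≤-trans heavier (maximal q (subst (λ z → k ≤ pos z) (Path.pm P) (P-out (Path.m P) ≤-refl)))))
    where
    q = Path.p W j
    P-out : Unnumbered k pos P
    P-out l l≤ with within l l≤
    ... | i , i≤ , eq = subst (λ z → k ≤ pos z) (sym eq) (out i (≤-trans i≤ (s≤s⁻¹ j<sm)))
    -- before its end, P only uses vertices before position j of W
    t-end : ∀ l → l < Path.m P → tadj t (Path.p P l) ≡ false
    t-end l l< with within l (<⇒≤ l<)
    ... | i , i≤ , eq with m≤n⇒m<n∨m≡n i≤
    ...   | inj₂ refl = ⊥-elim (<-irrefl (distinct l (Path.m P) (<⇒≤ l<) ≤-refl (trans eq (sym (Path.pm P)))) l<)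
    ...   | inj₁ i<j with tadj t (Path.p P l) in e2
    ...     | false = refl
    ...     | true = ⊥-elim (least i i<j (trans (cong (tadj t) (sym eq)) e2))
    tq : tadj t q ≡ true
    tq = tj
    neighbour : ∀ s → numbered k pos s ∧ tadj s c ≡ true → numbered k pos s ∧ tadj s q ≡ true
    neighbour s h with ∧-true {numbered k pos s} h
    ... | ns , sc = true-∧ ns (neighbour-reaches-end k pos inv P induced P-out t tin t-end tq s (does-true (pos s <? k) ns)
                                 (λ { refl → t≢f (trans (sym sc) tc) }) sc)
    heavier : weight k pos c < weight k pos q
    heavier = countFin-strict _ _ neighbour t (true-∧ (dec-true (pos t <? k) tin) tq)
                (cong₂ _∧_ (dec-true (pos t <? k) tin) tc)

module ArgMax {n} (D : Fin n → Set) (D? : ∀ u → Dec (D u)) (f : Fin n → ℕ) where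
  maxIn : (L : List (Fin n)) (c0 : Fin n) → D c0 → ∃ λ c → D c × (∀ d → d ∈ L → D d → f d ≤ f c)
  maxIn [] c0 d0 = c0 , d0 , λ _ ()
  maxIn (x ∷ L) c0 d0 with maxIn L c0 d0
  ... | c , dc , h with D? x | f c <? f x
  ...   | yes dx | yes lt = x , dx , h'
    where
    h' : ∀ d → d ∈ (x ∷ L) → D d → f d ≤ f x
    h' d (here refl) _ = ≤-refl
    h' d (there m) dd = ≤-trans (h d m dd) (<⇒≤ lt)
  ...   | yes dx | no ¬lt = c , dc , h'
    where
    h' : ∀ d → d ∈ (x ∷ L) → D d → f d ≤ f c
    h' d (here refl) _ = ≮⇒≥ ¬lt
    h' d (there m) dd = h d m dd
  ...   | no ¬dx | _ = c , dc , h'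
    where
    h' : ∀ d → d ∈ (x ∷ L) → D d → f d ≤ f c
    h' d (here refl) dd = ⊥-elim (¬dx dd)
    h' d (there m) dd = h d m dd

  argmax : (c0 : Fin n) → D c0 → ∃ λ c → D c × (∀ d → D d → f d ≤ f c)
  argmax c0 d0 with maxIn (allFin n) c0 d0
  ... | c , dc , h = c , dc , λ d dd → h d (∈-allFin d) dd

module MCSOrdering {n} (G : Graph n) (hyp : HoleUniqueEdgeProperty G) (Gc : Connected G) where
  open TriangleGraph G
  open MaximumCardinalitySearch G hyp
  open PathOps T

  record Numbering : Set where
    field
      k         : ℕ
      pos       : Fin n → ℕ
      range     : ∀ u → pos u < k ⊎ pos u ≡ n
      pos-inj   : ∀ u v → pos u < k → pos u ≡ pos v → u ≡ v
      pos-onto  : ∀ j → j < k → ∃ λ u → pos u ≡ j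
      invariant : MCSInvariant k pos
      clique    : ∀ c u u' → pos c < k → pos u < pos c → pos u' < pos c → tadj u c ≡ true → tadj u' c ≡ true →
                  u ≡ u' ⊎ tadj u u' ≡ true
      linked    : ∀ c → pos c < k → pos c ≡ 0 ⊎ ∃ λ u → pos u < pos c × adj G u c ≡ true

  empty : Numbering
  empty = record
    { k = 0 ; pos = λ _ → n ; range = λ _ → inj₂ refl
    ; pos-inj = λ _ _ () ; pos-onto = λ _ () ; invariant = λ _ _ _ _ _ _ () ; clique = λ _ _ _ () ; linked = λ _ () }

  -- The next vertex: an unnumbered vertex of maximum weight, chosen among
  -- the G-neighbours of numbered vertices when the maximum weight is 0.
  module Choose (N : Numbering) (k<n : Numbering.k N < n) (x0 : Fin n) (x0-unnumbered : Numbering.pos N x0 ≡ n) where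
    open Numbering N

    unnumbered : ∀ {u} → k ≤ pos u → pos u ≡ n
    unnumbered {u} h with range u
    ... | inj₁ lt = ⊥-elim (<-irrefl refl (<-≤-trans lt h))
    ... | inj₂ e = e

    Choice : Set
    Choice = ∃ λ c → pos c ≡ n × (∀ d → k ≤ pos d → weight k pos d ≤ weight k pos c) ×
                     (k ≡ 0 ⊎ ∃ λ u → pos u < k × adj G u c ≡ true)

    choose : Choice
    choose with ArgMax.argmax (λ u → pos u ≡ n) (λ u → pos u ≟ n) (weight k pos) x0 x0-unnumbered
    ... | c0 , c0-unnumbered , c0-max = byWeight (weight k pos c0 ≟ 0)
      where
      maximal : ∀ d → k ≤ pos d → weight k pos d ≤ weight k pos c0
      maximal d h = c0-max d (unnumbered h)
      byWeight : Dec (weight k pos c0 ≡ 0) → Choice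
      -- positive weight: c0 has a numbered T-neighbour, hence a G-neighbour
      byWeight (no nz) with countFin-pos (λ s → numbered k pos s ∧ tadj s c0) (≤∧≢⇒< z≤n (λ e → nz (sym e)))
      ... | s , e with ∧-true {numbered k pos s} e
      ... | ns , sc = c0 , c0-unnumbered , maximal , inj₂ (s , does-true (pos s <? k) ns , T⊆G sc)
      -- weight 0: all unnumbered weights are 0; use connectivity of G
      byWeight (yes z) with k ≟ 0
      ... | yes k0 = c0 , c0-unnumbered , maximal , inj₁ k0
      ... | no k≢0 with pos-onto 0 (≤∧≢⇒< z≤n (λ e → k≢0 (sym e)))
      ... | u0 , pu0 with crossingEdge G (λ u → pos u < k) (λ u → pos u <? k) (Gc u0 c0)
                            (subst (_< k) (sym pu0) (≤∧≢⇒< z≤n (λ e → k≢0 (sym e))))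
                            (λ h → <-irrefl refl (<-≤-trans h (subst (k ≤_) (sym c0-unnumbered) (<⇒≤ k<n))))
      ... | u , v , uin , vout , a = v , unnumbered (≮⇒≥ vout) , maximal' , inj₂ (u , uin , a)
        where
        maximal' : ∀ d → k ≤ pos d → weight k pos d ≤ weight k pos v
        maximal' d h = ≤-trans (maximal d h) (subst (_≤ weight k pos v) (sym z) z≤n)

  module Extend (N : Numbering) (k<n : Numbering.k N < n) (c : Fin n) (c-unnumbered : Numbering.pos N c ≡ n)
                (c-max : ∀ d → Numbering.k N ≤ Numbering.pos N d →
                         weight (Numbering.k N) (Numbering.pos N) d ≤ weight (Numbering.k N) (Numbering.pos N) c)
                (c-linked : Numbering.k N ≡ 0 ⊎ ∃ λ u → Numbering.pos N u < Numbering.k N × adj G u c ≡ true) where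
    open Numbering N

    pos' : Fin n → ℕ
    pos' u with u F.≟ c
    ... | yes _ = k
    ... | no _ = pos u

    pos'-c : ∀ {u} → u ≡ c → pos' u ≡ k
    pos'-c {u} refl with u F.≟ u
    ... | yes _ = refl
    ... | no ne = ⊥-elim (ne refl)

    pos'-other : ∀ {u} → u ≢ c → pos' u ≡ pos u
    pos'-other {u} ne with u F.≟ c
    ... | yes e = ⊥-elim (ne e)
    ... | no _ = refl

    c-late : k ≤ pos c
    c-late = subst (k ≤_) (sym c-unnumbered) (<⇒≤ k<n)

    numbered≢c : ∀ {u} → pos u < k → u ≢ c
    numbered≢c {u} h refl = <-irrefl refl (<-≤-trans h c-late)

    wasNumbered : ∀ {u} → u ≢ c → pos' u < suc k → pos u < k
    wasNumbered {u} ne h with range u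
    ... | inj₁ lt = lt
    ... | inj₂ e = ⊥-elim (<-irrefl refl (<-≤-trans k<n (subst (_≤ k) e (s≤s⁻¹ (subst (_< suc k) (pos'-other ne) h)))))

    pos-not-k : ∀ {v} → v ≢ c → pos v ≢ k
    pos-not-k {v} nv e with range v
    ... | inj₁ lt = <-irrefl e lt
    ... | inj₂ en = <-irrefl (trans (sym e) en) k<n

    stillUnnumbered : ∀ {v} → suc k ≤ pos' v → v ≢ c × k ≤ pos v
    stillUnnumbered {v} h = byCase (v F.≟ c)
      where
      byCase : Dec (v ≡ c) → v ≢ c × k ≤ pos v
      byCase (yes e) = ⊥-elim (<-irrefl (sym (pos'-c e)) h)
      byCase (no ne) = ne , ≤-trans (n≤1+n k) (subst (suc k ≤_) (pos'-other ne) h)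

    range' : ∀ u → pos' u < suc k ⊎ pos' u ≡ n
    range' u = byCase (u F.≟ c)
      where
      byCase : Dec (u ≡ c) → pos' u < suc k ⊎ pos' u ≡ n
      byCase (yes e) = inj₁ (subst (_< suc k) (sym (pos'-c e)) ≤-refl)
      byCase (no ne) with range u
      ... | inj₁ lt = inj₁ (subst (_< suc k) (sym (pos'-other ne)) (m<n⇒m<1+n lt))
      ... | inj₂ e = inj₂ (trans (pos'-other ne) e)

    pos'-inj : ∀ u v → pos' u < suc k → pos' u ≡ pos' v → u ≡ v
    pos'-inj u v h e = byCase (u F.≟ c) (v F.≟ c)
      where
      byCase : Dec (u ≡ c) → Dec (v ≡ c) → u ≡ v
      byCase (yes eu) (yes ev) = trans eu (sym ev)
      byCase (yes eu) (no nv) = ⊥-elim (pos-not-k nv (trans (sym (pos'-other nv)) (trans (sym e) (pos'-c eu))))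
      byCase (no nu) (yes ev) = ⊥-elim (pos-not-k nu (trans (sym (pos'-other nu)) (trans e (pos'-c ev))))
      byCase (no nu) (no nv) = pos-inj u v (wasNumbered nu h) (trans (sym (pos'-other nu)) (trans e (pos'-other nv)))

    pos'-onto : ∀ j → j < suc k → ∃ λ u → pos' u ≡ j
    pos'-onto j h with m≤n⇒m<n∨m≡n (s≤s⁻¹ h)
    ... | inj₂ refl = c , pos'-c refl
    ... | inj₁ lt with pos-onto j lt
    ...   | u , pu = u , trans (pos'-other (numbered≢c (subst (_< k) (sym pu) lt))) pu

    earlierThanOld : ∀ {u w} → w ≢ c → pos' w < suc k → pos' u < pos' w → u ≢ c × pos u < pos w
    earlierThanOld {u} {w} nw hw lt = nu , subst₂ _<_ (pos'-other nu) (pos'-other nw) lt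
      where
      nu : u ≢ c
      nu e = <-irrefl refl (<-≤-trans (subst (_< pos' w) (pos'-c e) lt)
                                       (subst (_≤ k) (sym (pos'-other nw)) (<⇒≤ (wasNumbered nw hw))))

    earlierThanNew : ∀ {u w} → w ≡ c → pos' u < pos' w → u ≢ c × pos u < k
    earlierThanNew {u} {w} ew lt = nu , subst (_< k) (pos'-other nu) (subst (pos' u <_) (pos'-c ew) lt)
      where
      nu : u ≢ c
      nu e = <-irrefl (trans (pos'-c e) (sym (pos'-c ew))) lt

    -- the new earlier-neighbour clique of c: the MCS invariant applied to
    -- the trivial path at c
    clique' : ∀ c' u u' → pos' c' < suc k → pos' u < pos' c' → pos' u' < pos' c' → tadj u c' ≡ true → tadj u' c' ≡ true →
              u ≡ u' ⊎ tadj u u' ≡ true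
    clique' c' u u' h1 h2 h3 tu tu' = byCase (c' F.≟ c)
      where
      byCase : Dec (c' ≡ c) → u ≡ u' ⊎ tadj u u' ≡ true
      byCase (yes e) = invariant c c (trivialPath c) (λ i _ → c-late) u u'
                         (proj₂ (earlierThanNew e h2)) (proj₂ (earlierThanNew e h3))
                         (subst (λ z → tadj u z ≡ true) e tu) (subst (λ z → tadj u' z ≡ true) e tu')
      byCase (no ne) = clique c' u u' (wasNumbered ne h1) (proj₂ (earlierThanOld ne h1 h2)) (proj₂ (earlierThanOld ne h1 h3)) tu tu'

    linked' : ∀ c' → pos' c' < suc k → pos' c' ≡ 0 ⊎ ∃ λ u → pos' u < pos' c' × adj G u c' ≡ true
    linked' c' h = byCase (c' F.≟ c)
      where
      byCase : Dec (c' ≡ c) → pos' c' ≡ 0 ⊎ ∃ λ u → pos' u < pos' c' × adj G u c' ≡ true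
      byCase (yes e) = fromChoice c-linked
        where
        fromChoice : (k ≡ 0 ⊎ ∃ λ u → pos u < k × adj G u c ≡ true) → pos' c' ≡ 0 ⊎ ∃ λ u → pos' u < pos' c' × adj G u c' ≡ true
        fromChoice (inj₁ k0) = inj₁ (trans (pos'-c e) k0)
        fromChoice (inj₂ (u , lt , a)) = inj₂ (u , subst₂ _<_ (sym (pos'-other (numbered≢c lt))) (sym (pos'-c e)) lt ,
                                             subst (λ z → adj G u z ≡ true) (sym e) a)
      byCase (no ne) with linked c' (wasNumbered ne h)
      ... | inj₁ z = inj₁ (trans (pos'-other ne) z)
      ... | inj₂ (u , lt , a) = inj₂ (u , subst₂ _<_ (sym (pos'-other (numbered≢c (<-trans lt (wasNumbered ne h)))))
                                                      (sym (pos'-other ne)) lt , a)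

    -- Preservation of the MCS invariant.  For an unnumbered path x … y with
    -- c T-adjacent to x, prepend c and apply `mcs-key`; symmetrically at y.
    invariant' : MCSInvariant (suc k) pos'
    invariant' x y W out s t hs ht sx ty = byCase (s F.≟ c) (t F.≟ c)
      where
      outOld : Unnumbered k pos W
      outOld i le = proj₂ (stillUnnumbered (out i le))
      byCase : Dec (s ≡ c) → Dec (t ≡ c) → s ≡ t ⊎ tadj s t ≡ true
      byCase (yes es) (yes et) = inj₁ (trans es (sym et))
      byCase (yes refl) (no nt) = inj₂ (tadj-sym (mcs-key k pos invariant c c-max t y (prepend c sx W)
                                        (prepend-all c sx W (λ v → k ≤ pos v) c-late outOld) (wasNumbered nt ht) ty))
      byCase (no ns) (yes refl) = inj₂ (mcs-key k pos invariant c c-max s x (prepend c ty (reverse W))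
                                        (prepend-all c ty (reverse W) (λ v → k ≤ pos v) c-late (reverse-all W (λ v → k ≤ pos v) outOld))
                                        (wasNumbered ns hs) sx)
      byCase (no ns) (no nt) = invariant x y W outOld s t (wasNumbered ns hs) (wasNumbered nt ht) sx ty

    extended : Numbering
    extended = record { k = suc k ; pos = pos' ; range = range' ; pos-inj = pos'-inj ; pos-onto = pos'-onto
                      ; invariant = invariant' ; clique = clique' ; linked = linked' }

  -- When all n positions are used, no vertex is left unnumbered: otherwise
  -- the positions 0 … n - 1 together with x0 would give n + 1 distinct
  -- vertices.
  full : (N : Numbering) → Numbering.k N ≡ n → ∀ x0 → Numbering.pos N x0 ≡ n → ⊥
  full N kn x0 x0n = <-irrefl refl (injective⇒≤ {f = φ} (λ {a} {b} → φ-inj a b (toℕ a <? k) (toℕ b <? k)))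
    where
    open Numbering N
    vertexAt : (j : Fin (suc n)) → Dec (toℕ j < k) → Fin n
    vertexAt j (yes h) = proj₁ (pos-onto (toℕ j) h)
    vertexAt j (no _) = x0
    φ : Fin (suc n) → Fin n
    φ j = vertexAt j (toℕ j <? k)
    last : ∀ (j : Fin (suc n)) → ¬ toℕ j < k → toℕ j ≡ n
    last j h = ≤-antisym (s≤s⁻¹ (toℕ<n j)) (subst (_≤ toℕ j) kn (≮⇒≥ h))
    φ-inj : ∀ a b (da : Dec (toℕ a < k)) (db : Dec (toℕ b < k)) → vertexAt a da ≡ vertexAt b db → a ≡ b
    φ-inj a b (yes ha) (yes hb) e =
      toℕ-injective (trans (sym (proj₂ (pos-onto (toℕ a) ha))) (trans (cong pos e) (proj₂ (pos-onto (toℕ b) hb))))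
    φ-inj a b (yes ha) (no hb) e =
      ⊥-elim (<-irrefl (trans (sym (proj₂ (pos-onto (toℕ a) ha))) (trans (cong pos e) (trans x0n (sym kn)))) ha)
    φ-inj a b (no ha) (yes hb) e =
      ⊥-elim (<-irrefl (trans (sym (proj₂ (pos-onto (toℕ b) hb))) (trans (cong pos (sym e)) (trans x0n (sym kn)))) hb)
    φ-inj a b (no ha) (no hb) e = toℕ-injective (trans (last a ha) (sym (last b hb)))

  Complete : Set
  Complete = Σ Numbering λ N → ∀ u → Numbering.pos N u < Numbering.k N

  numberAll : (fuel : ℕ) (N : Numbering) → Numbering.k N + fuel ≡ n → Complete
  numberAll fuel N eq with any? (λ u → Numbering.pos N u ≟ n)
  ... | no none = N , λ u → isNumbered u (Numbering.range N u)
    where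
    isNumbered : ∀ u → Numbering.pos N u < Numbering.k N ⊎ Numbering.pos N u ≡ n → Numbering.pos N u < Numbering.k N
    isNumbered u (inj₁ lt) = lt
    isNumbered u (inj₂ e) = ⊥-elim (none (u , e))
  numberAll zero N eq | yes (x0 , x0n) = ⊥-elim (full N (trans (sym (+-identityʳ _)) eq) x0 x0n)
  numberAll (suc fuel) N eq | yes (x0 , x0n) = extendWith (Choose.choose N k<n x0 x0n)
    where
    k<n : Numbering.k N < n
    k<n = subst (Numbering.k N <_) eq (m<m+n (Numbering.k N) z<s)
    extendWith : Choose.Choice N k<n x0 x0n → Complete
    extendWith (c , c-unnumbered , c-max , c-linked) =
      numberAll fuel (Extend.extended N k<n c c-unnumbered c-max c-linked) (trans (sym (+-suc (Numbering.k N) fuel)) eq)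

  mcsOrdering : Complete
  mcsOrdering = numberAll n empty refl

-- Every acyclic digraph on a nonempty vertex set has a sink: following
-- first out-arcs from x0 for N steps would otherwise repeat a vertex and
-- close a directed cycle.
module AcyclicSink {N : ℕ} (A : Fin N → Fin N → Bool) (acyclic : Acyclic A) (x0 : Fin N) where
  follow : Maybe (Fin N) → Fin N → Fin N
  follow (just v) _ = v
  follow nothing x = x

  walk : ℕ → Fin N
  walk zero = x0
  walk (suc i) = follow (firstFin (A (walk i))) (walk i)

  isNothing? : (m : Maybe (Fin N)) → Dec (m ≡ nothing)
  isNothing? nothing = yes refl
  isNothing? (just _) = no (λ ())

  arcOf : ∀ i → firstFin (A (walk i)) ≢ nothing → A (walk i) (walk (suc i)) ≡ true
  arcOf i ne = byOutArc (firstFin (A (walk i))) refl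
    where
    byOutArc : (m : Maybe (Fin N)) → firstFin (A (walk i)) ≡ m → A (walk i) (follow m (walk i)) ≡ true
    byOutArc (just v) e = firstFin-just (A (walk i)) e
    byOutArc nothing e = ⊥-elim (ne e)

  sink : ∃ λ x → ∀ v → A x v ≡ false
  sink with leastBelow (suc N) (λ i → isNothing? (firstFin (A (walk i))))
  ... | inj₁ (i , _ , e , _) = walk i , firstFin-nothing (A (walk i)) e
  ... | inj₂ none with pigeonhole ≤-refl (λ (j : Fin (suc N)) → walk (toℕ j))
  ...   | a , b , a<b , e with m≤n⇒∃[o]m+o≡n a<b
  ...     | d , ed = ⊥-elim (acyclic (walk (toℕ a)) (subst (DPath A (walk (toℕ a))) endEq (dpath (toℕ a) d bound)))
    where
    arcAt : ∀ i → i ≤ N → A (walk i) (walk (suc i)) ≡ true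
    arcAt i h = arcOf i (none i (s≤s h))
    dpath : ∀ a d → a + suc d ≤ N → DPath A (walk a) (walk (a + suc d))
    dpath a zero h = subst (λ z → DPath A (walk a) (walk z)) (sym (trans (+-suc a 0) (cong suc (+-identityʳ a))))
                       (arc (arcAt a (≤-trans (m≤m+n a 1) h)))
    dpath a (suc d) h = cons (arcAt a (≤-trans (m≤m+n a (suc (suc d))) h))
                          (subst (λ z → DPath A (walk (suc a)) (walk z)) (sym (+-suc a (suc d)))
                            (dpath (suc a) d (subst (_≤ N) (+-suc a (suc d)) h)))
    eb : toℕ a + suc d ≡ toℕ b
    eb = trans (+-suc (toℕ a) d) ed
    bound : toℕ a + suc d ≤ N
    bound = subst (_≤ N) (sym eb) (s≤s⁻¹ (toℕ<n b))
    endEq : walk (toℕ a + suc d) ≡ walk (toℕ a)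
    endEq = trans (cong walk eb) (sym e)

addIsolated-old : ∀ {n} (X : Graph n) (k : ℕ) (x y : Fin (n + k)) a b → splitAt n x ≡ inj₁ a → splitAt n y ≡ inj₁ b →
                  addIsolated X k x y ≡ adj X a b
addIsolated-old {n} X k x y a b ex ey with splitAt n x | splitAt n y
addIsolated-old {n} X k x y a b refl refl | inj₁ .a | inj₁ .b = refl

addIsolated-newˡ : ∀ {n} (X : Graph n) (k : ℕ) (x y : Fin (n + k)) r → splitAt n x ≡ inj₂ r → addIsolated X k x y ≡ false
addIsolated-newˡ {n} X k x y r ex with splitAt n x | splitAt n y
addIsolated-newˡ {n} X k x y r refl | inj₂ .r | inj₁ _ = refl
addIsolated-newˡ {n} X k x y r refl | inj₂ .r | inj₂ _ = refl

addIsolated-newʳ : ∀ {n} (X : Graph n) (k : ℕ) (x y : Fin (n + k)) a r → splitAt n x ≡ inj₁ a → splitAt n y ≡ inj₂ r →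
                   addIsolated X k x y ≡ false
addIsolated-newʳ {n} X k x y a r ex ey with splitAt n x | splitAt n y
addIsolated-newʳ {n} X k x y a r refl refl | inj₁ .a | inj₂ .r = refl

-- A graph with an edge at every vertex is not a competition graph of an
-- acyclic digraph (without extra vertices): a sink x of the digraph has a
-- neighbour y, and x, y would need a common prey.
not-competition-graph : ∀ {n} (X : Graph n) → (∀ u → ∃ λ w → adj X u w ≡ true) → Fin n → ¬ CompRepresentable X 0
not-competition-graph {n} X neighbour u0 (A , acyclic , competition) with AcyclicSink.sink A acyclic (u0 ↑ˡ 0)
... | x , x-sink = sinkHasNoPrey (splitAt n x) refl
  where
  sinkHasNoPrey : ∀ sx → splitAt n x ≡ sx → ⊥
  sinkHasNoPrey (inj₂ ())
  sinkHasNoPrey (inj₁ u) ex with neighbour u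
  ... | w , uw with Equivalence.to (competition x (w ↑ˡ 0) x≢w) (trans (addIsolated-old X 0 x (w ↑ˡ 0) u w ex ey) uw)
    where
    ey : splitAt n (w ↑ˡ 0) ≡ inj₁ w
    ey = splitAt-↑ˡ n w 0
    x≢w : x ≢ w ↑ˡ 0
    x≢w e = adj⇒≢ X uw (inj₁-injective (trans (sym ex) (trans (cong (splitAt n) e) ey)))
      where
      inj₁-injective : ∀ {a b : Fin n} → inj₁ {B = Fin 0} a ≡ inj₁ b → a ≡ b
      inj₁-injective refl = refl
  ... | v , xv , _ = t≢f (trans (sym xv) (x-sink v))

module Construction {n} (G : Graph n) (k : ℕ) (pos : Fin n → ℕ)
  (pos-inj : ∀ u v → pos u < k → pos u ≡ pos v → u ≡ v)
  (numbered : ∀ u → pos u < k)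
  (clique : ∀ c u u' → pos c < k → pos u < pos c → pos u' < pos c → TriangleGraph.tadj G u c ≡ true →
            TriangleGraph.tadj G u' c ≡ true → u ≡ u' ⊎ TriangleGraph.tadj G u u' ≡ true)
  (linked : ∀ c → pos c < k → pos c ≡ 0 ⊎ ∃ λ u → pos u < pos c × adj G u c ≡ true)
  (pos-onto : ∀ j → j < k → ∃ λ u → pos u ≡ j) where
  open TriangleGraph G

  earlier : Fin n → Fin n → Bool
  earlier c u = does (pos u <? pos c)

  earlyT earlyG : Fin n → Fin n → Bool
  earlyT c u = earlier c u ∧ tadj u c
  earlyG c u = earlier c u ∧ adj G u c

  is : Maybe (Fin n) → Fin n → Bool
  is nothing u = false
  is (just v) u = eqb v u

  is-true : ∀ {m : Maybe (Fin n)} {u} → is m u ≡ true → m ≡ just u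
  is-true {m = just v} e = cong just (eqb-true e)

  below : Fin n → Fin n → Bool
  below c u = earlyT c u ∨ (not (anyFin (earlyT c)) ∧ is (firstFin (earlyG c)) u)

  below-cases : ∀ {c u} → below c u ≡ true → earlyT c u ≡ true ⊎ (anyFin (earlyT c) ≡ false × firstFin (earlyG c) ≡ just u)
  below-cases {c} {u} e with ∨-true {earlyT c u} e
  ... | inj₁ q = inj₁ q
  ... | inj₂ q with ∧-true {not (anyFin (earlyT c))} q
  ... | a , b = inj₂ (not-true a , is-true b)

  below-earlyG : ∀ {c u} → below c u ≡ true → earlyG c u ≡ true
  below-earlyG {c} {u} e with below-cases {c} {u} e
  ... | inj₁ q = true-∧ (proj₁ (∧-true {earlier c u} q)) (T⊆G (proj₂ (∧-true {earlier c u} q)))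
  ... | inj₂ (_ , q) = firstFin-just (earlyG c) q

  below-earlier : ∀ {c u} → below c u ≡ true → pos u < pos c
  below-earlier {c} {u} e = does-true (pos u <? pos c) (proj₁ (∧-true {earlier c u} (below-earlyG {c} {u} e)))

  below-adj : ∀ {c u} → below c u ≡ true → adj G u c ≡ true
  below-adj {c} {u} e = proj₂ (∧-true {earlier c u} (below-earlyG {c} {u} e))

  below-irrefl : ∀ u → below u u ≡ false
  below-irrefl u with below u u in e
  ... | false = refl
  ... | true = ⊥-elim (<-irrefl refl (below-earlier {u} {u} e))

  earlyT-below : ∀ {c u} → earlyT c u ≡ true → below c u ≡ true
  earlyT-below e rewrite e = refl

  G' : Graph n
  G' = record { adj = λ u w → below w u ∨ below u w ; sym = λ u w → ∨-comm (below w u) (below u w)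
              ; irrefl = λ u → cong₂ _∨_ (below-irrefl u) (below-irrefl u) }

  G'-below : ∀ {c u} → below c u ≡ true → adj G' u c ≡ true
  G'-below {c} {u} e rewrite e = refl

  G'-spanning : SpanningSubgraph G' G
  G'-spanning x y e with ∨-true {below y x} e
  ... | inj₁ q = below-adj {y} {x} q
  ... | inj₂ q = adj-sym G (below-adj {x} {y} q)

  T⊆G' : ∀ {x y} → tadj x y ≡ true → adj G' x y ≡ true
  T⊆G' {x} {y} t with <-cmp (pos x) (pos y)
  ... | tri< lt _ _ = G'-below (earlyT-below {y} {x} (true-∧ (dec-true (pos x <? pos y) lt) t))
  ... | tri≈ _ e _ = ⊥-elim (adj⇒≢ T t (pos-inj x y (numbered x) e))
  ... | tri> _ _ gt = adj-sym G' (G'-below (earlyT-below {x} {y} (true-∧ (dec-true (pos y <? pos x) gt) (tadj-sym t))))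

  G'-triangles : ContainsTriangles G' G
  G'-triangles x y z xy yz xz =
    T⊆G' (triangle⇒T xy xz yz) , T⊆G' (triangle⇒T yz (adj-sym G xy) (adj-sym G xz)) , T⊆G' (triangle⇒T xz xy (adj-sym G yz))

  -- The earlier G'-neighbours of c are pairwise G'-adjacent: either they are
  -- its earlier T-neighbours (a T-clique by hypothesis) or a single vertex.
  below-clique : ∀ {c u u'} → below c u ≡ true → below c u' ≡ true → u ≢ u' → adj G' u u' ≡ true
  below-clique {c} {u} {u'} e e' ne with below-cases {c} {u} e | below-cases {c} {u'} e'
  ... | inj₁ q | inj₁ q' with ∧-true {earlier c u} q | ∧-true {earlier c u'} q'
  ...   | l , t | l' , t' with clique c u u' (numbered c) (does-true (pos u <? pos c) l) (does-true (pos u' <? pos c) l') t t'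
  ...     | inj₁ eq = ⊥-elim (ne eq)
  ...     | inj₂ tu = T⊆G' tu
  below-clique {c} {u} {u'} e e' ne | inj₁ q | inj₂ (none , _) = ⊥-elim (t≢f (trans (sym (anyFin-complete (earlyT c) u q)) none))
  below-clique {c} {u} {u'} e e' ne | inj₂ (none , _) | inj₁ q' = ⊥-elim (t≢f (trans (sym (anyFin-complete (earlyT c) u' q')) none))
  below-clique {c} {u} {u'} e e' ne | inj₂ (_ , j) | inj₂ (_ , j') = ⊥-elim (ne (just-injective (trans (sym j) j')))
    where
    just-injective : ∀ {a b : Fin n} → just a ≡ just b → a ≡ b
    just-injective refl = refl

  parent : ∀ c → pos c ≢ 0 → ∃ λ u → pos u < pos c × below c u ≡ true
  parent c nz = byEarlyT (anyFin (earlyT c) Bool.≟ true)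
    where
    byEarlyT : Dec (anyFin (earlyT c) ≡ true) → ∃ λ u → pos u < pos c × below c u ≡ true
    byEarlyT (yes hasEarlyT) with anyFin-sound (earlyT c) hasEarlyT
    ... | u , eu = u , does-true (pos u <? pos c) (proj₁ (∧-true {earlier c u} eu)) , earlyT-below {c} {u} eu
    byEarlyT (no noEarlyT) with linked c (numbered c)
    ... | inj₁ z = ⊥-elim (nz z)
    ... | inj₂ (u , lt , a) = fromFirst (firstFin (earlyG c)) refl
      where
      fromFirst : (m : Maybe (Fin n)) → firstFin (earlyG c) ≡ m → ∃ λ u → pos u < pos c × below c u ≡ true
      fromFirst nothing first = ⊥-elim (t≢f (trans (sym (true-∧ (dec-true (pos u <? pos c) lt) a)) (firstFin-nothing (earlyG c) first u)))
      fromFirst (just v) first = v , does-true (pos v <? pos c) (proj₁ (∧-true {earlier c v} (firstFin-just (earlyG c) first))) , isBelow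
        where
        isBelow : below c v ≡ true
        isBelow rewrite ≢true⇒false noEarlyT | first | eqb-refl v = ∨-zeroʳ (earlyT c v)

  -- G' is connected: following earlier neighbours leads to the first vertex.
  module _ (r0 : Fin n) (r0-first : pos r0 ≡ 0) where
    toFirst : (fuel : ℕ) (c : Fin n) → pos c ≤ fuel → Walk G' c r0
    toFirst fuel c le with pos c ≟ 0
    ... | yes z = subst (λ w → Walk G' w r0) (pos-inj r0 c (numbered r0) (trans r0-first (sym z))) here
    toFirst zero c le | no nz = ⊥-elim (nz (≤-antisym le z≤n))
    toFirst (suc fuel) c le | no nz with parent c nz
    ... | u , lt , pu = step (adj-sym G' (G'-below pu)) (toFirst fuel u (s≤s⁻¹ (<-≤-trans lt le)))

    G'-connected : Connected G'
    G'-connected x y = walk-append (toFirst (pos x) x ≤-refl) (walk-reverse (toFirst (pos y) y ≤-refl))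

  member : Fin n → Fin n → Bool
  member u c = eqb u c ∨ below c u

  member-cases : ∀ {u c} → member u c ≡ true → u ≡ c ⊎ below c u ≡ true
  member-cases {u} {c} e with ∨-true {eqb u c} e
  ... | inj₁ q = inj₁ (eqb-true q)
  ... | inj₂ q = inj₂ q

  member-earlier : ∀ {u c} → member u c ≡ true → pos u ≤ pos c
  member-earlier {u} {c} e with member-cases {u} {c} e
  ... | inj₁ refl = ≤-refl
  ... | inj₂ q = <⇒≤ (below-earlier {c} {u} q)

  member-self : ∀ c → member c c ≡ true
  member-self c rewrite eqb-refl c = refl

  member-below : ∀ {u c} → below c u ≡ true → member u c ≡ true
  member-below {u} {c} e rewrite e = ∨-zeroʳ (eqb u c)

  member-clique : ∀ {a b c} → member a c ≡ true → member b c ≡ true → a ≢ b → adj G' a b ≡ true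
  member-clique {a} {b} {c} ma mb ne with member-cases {a} {c} ma | member-cases {b} {c} mb
  ... | inj₁ refl | inj₁ refl = ⊥-elim (ne refl)
  ... | inj₁ refl | inj₂ q = adj-sym G' (G'-below q)
  ... | inj₂ q | inj₁ refl = G'-below q
  ... | inj₂ q | inj₂ q' = below-clique {c} {a} {b} q q' ne

  -- The digraph on the vertices of G plus one new vertex ★ of height k:
  -- every member of N[c] preys on the vertex of height pos c + 1, that is
  -- the next vertex, or ★ if c is the last one.
  height : Fin n ⊎ Fin 1 → ℕ
  height (inj₁ u) = pos u
  height (inj₂ _) = k

  isNext : Fin n → ℕ → Bool
  isNext c j = does (suc (pos c) ≟ j)

  preys : Fin n ⊎ Fin 1 → Fin n ⊎ Fin 1 → Bool
  preys (inj₁ u) v = anyFin (λ c → isNext c (height v) ∧ member u c)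
  preys (inj₂ _) _ = false

  Arc : Fin (n + 1) → Fin (n + 1) → Bool
  Arc x y = preys (splitAt n x) (splitAt n y)

  preys-witness : ∀ u v → preys (inj₁ u) v ≡ true → ∃ λ c → suc (pos c) ≡ height v × member u c ≡ true
  preys-witness u v e with anyFin-sound _ e
  ... | c , q with ∧-true {isNext c (height v)} q
  ... | nx , m = c , does-true (suc (pos c) ≟ height v) nx , m

  -- Arcs increase the height, so the digraph is acyclic.
  preys-higher : ∀ a b → preys a b ≡ true → height a < height b
  preys-higher (inj₁ u) v e with preys-witness u v e
  ... | c , next , m = subst (pos u <_) next (s≤s (member-earlier {u} {c} m))

  dpath-higher : ∀ {x y} → DPath Arc x y → height (splitAt n x) < height (splitAt n y)
  dpath-higher {x} {y} (arc e) = preys-higher (splitAt n x) (splitAt n y) e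
  dpath-higher {x} {z} (cons {y = y} e d) = <-trans (preys-higher (splitAt n x) (splitAt n y) e) (dpath-higher d)

  Arc-acyclic : Acyclic Arc
  Arc-acyclic x d = <-irrefl refl (dpath-higher d)

  nextVertex : ∀ c → Dec (suc (pos c) < k) → ∃ λ v → ∃ λ w → splitAt n v ≡ w × suc (pos c) ≡ height w
  nextVertex c (yes lt) with pos-onto (suc (pos c)) lt
  ... | w , pw = (w ↑ˡ 1) , inj₁ w , splitAt-↑ˡ n w 1 , sym pw
  nextVertex c (no nlt) = (n ↑ʳ F.zero) , inj₂ F.zero , splitAt-↑ʳ n 1 F.zero , sucEq (numbered c) nlt

  preyOf : ∀ c → ∃ λ v → ∀ u → member u c ≡ true → preys (inj₁ u) (splitAt n v) ≡ true
  preyOf c with nextVertex c (suc (pos c) <? k)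
  ... | v , w , split , next = v , λ u m → subst (λ z → preys (inj₁ u) z ≡ true) (sym split)
                                  (anyFin-complete _ c (true-∧ (dec-true (suc (pos c) ≟ height w) next) m))

  -- Two vertices with a common prey lie in a common N[c], since c is
  -- determined by the height of the prey.
  commonPrey⇒adj : ∀ a b v → a ≢ b → preys (inj₁ a) v ≡ true → preys (inj₁ b) v ≡ true → adj G' a b ≡ true
  commonPrey⇒adj a b v ne e1 e2 with preys-witness a v e1 | preys-witness b v e2
  ... | c1 , next1 , m1 | c2 , next2 , m2 with pos-inj c1 c2 (numbered c1) (suc-injective (trans next1 (sym next2)))
  ... | refl = member-clique {a} {b} {c1} m1 m2 ne

  adj⇒commonPrey : ∀ a b → adj G' a b ≡ true →
                   ∃ λ v → preys (inj₁ a) (splitAt n v) ≡ true × preys (inj₁ b) (splitAt n v) ≡ true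
  adj⇒commonPrey a b e with ∨-true {below b a} e
  ... | inj₁ q with preyOf b
  ...   | v , h = v , h a (member-below {a} {b} q) , h b (member-self b)
  adj⇒commonPrey a b e | inj₂ q with preyOf a
  ...   | v , h = v , h a (member-self a) , h b (member-below {b} {a} q)

  Arc-competition : IsCompetitionGraphOf (addIsolated G' 1) Arc
  Arc-competition x y x≢y = bySplit (splitAt n x) refl (splitAt n y) refl
    where
    bySplit : ∀ sx → splitAt n x ≡ sx → ∀ sy → splitAt n y ≡ sy →
              (addIsolated G' 1 x y ≡ true) ⇔ (∃[ v ] (Arc x v ≡ true × Arc y v ≡ true))
    bySplit (inj₁ a) ex (inj₁ b) ey = mk⇔ to from
      where
      a≢b : a ≢ b
      a≢b e = x≢y (trans (sym (splitAt⁻¹-↑ˡ ex)) (trans (cong (_↑ˡ 1) e) (splitAt⁻¹-↑ˡ ey)))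
      to : addIsolated G' 1 x y ≡ true → ∃[ v ] (Arc x v ≡ true × Arc y v ≡ true)
      to h with adj⇒commonPrey a b (trans (sym (addIsolated-old G' 1 x y a b ex ey)) h)
      ... | v , h1 , h2 = v , subst (λ z → preys z (splitAt n v) ≡ true) (sym ex) h1 ,
                              subst (λ z → preys z (splitAt n v) ≡ true) (sym ey) h2
      from : ∃[ v ] (Arc x v ≡ true × Arc y v ≡ true) → addIsolated G' 1 x y ≡ true
      from (v , h1 , h2) = trans (addIsolated-old G' 1 x y a b ex ey)
        (commonPrey⇒adj a b (splitAt n v) a≢b (subst (λ z → preys z (splitAt n v) ≡ true) ex h1)
                                               (subst (λ z → preys z (splitAt n v) ≡ true) ey h2))
    bySplit (inj₁ a) ex (inj₂ r) ey = mk⇔ (λ h → ⊥-elim (t≢f (trans (sym h) (addIsolated-newʳ G' 1 x y a r ex ey))))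
      (λ { (v , h1 , h2) → ⊥-elim (t≢f (trans (sym h2) (cong (λ z → preys z (splitAt n v)) ey))) })
    bySplit (inj₂ r) ex sy ey = mk⇔ (λ h → ⊥-elim (t≢f (trans (sym h) (addIsolated-newˡ G' 1 x y r ex))))
      (λ { (v , h1 , h2) → ⊥-elim (t≢f (trans (sym h1) (cong (λ z → preys z (splitAt n v)) ex))) })

  G'∪I₁-representable : CompRepresentable G' 1
  G'∪I₁-representable = Arc , Arc-acyclic , Arc-competition

connected⇒neighbour : ∀ {n} (X : Graph n) → 2 ≤ n → Connected X → ∀ u → ∃ λ w → adj X u w ≡ true
connected⇒neighbour {suc (suc m)} X _ connected u = firstStep (connected u (other u)) (other≢ u)
  where
  other : Fin (suc (suc m)) → Fin (suc (suc m))
  other F.zero = F.suc F.zero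
  other (F.suc _) = F.zero
  other≢ : ∀ u → other u ≢ u
  other≢ F.zero ()
  other≢ (F.suc _) ()
  firstStep : ∀ {o} → Walk X u o → o ≢ u → ∃ λ w → adj X u w ≡ true
  firstStep here ne = ⊥-elim (ne refl)
  firstStep (step {y = w} e _) ne = w , e
connected⇒neighbour {suc zero} X (s≤s ()) _ _

competitionNumber-one : ∀ {n} (X : Graph n) → 2 ≤ n → Connected X → CompRepresentable X 1 → CompetitionNumberIs X 1
competitionNumber-one {suc (suc m)} X two connected rep =
  rep , λ { zero _ → not-competition-graph X (connected⇒neighbour X two connected) F.zero ; (suc j) (s≤s ()) }
competitionNumber-one {suc zero} X (s≤s ()) _ _

mainTheorem9 : ∀ (n : ℕ) (G : Graph n) → n ≥ 2 → Connected G → HoleUniqueEdgeProperty G →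
    ∃[ G' ] (SpanningSubgraph G' G × Connected G' × ContainsTriangles G' G × CompetitionNumberIs G' 1)
mainTheorem9 (suc (suc _)) G two connected hyp =
  G' , G'-spanning , G'-connected' , G'-triangles , competitionNumber-one G' two G'-connected' G'∪I₁-representable
  where
  open MCSOrdering G hyp connected
  N : Numbering
  N = proj₁ mcsOrdering
  allNumbered : ∀ u → Numbering.pos N u < Numbering.k N
  allNumbered = proj₂ mcsOrdering
  open Numbering N
  open Construction G k pos pos-inj allNumbered clique linked pos-onto
  first : ∃ λ r → pos r ≡ 0
  first = pos-onto 0 (≤-<-trans z≤n (allNumbered F.zero))
  G'-connected' : Connected G'
  G'-connected' = G'-connected (proj₁ first) (proj₂ first)
mainTheorem9 (suc zero) G (s≤s ()) connected hyp
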